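{- Let $\mathcal{A}$ be a generalized Rabin automaton with $n$ states and one generalized Rabin pair containing $\ell$ $\mathrm{Inf}$-atoms, i.e., with acceptance condition $\mathrm{Fin}(c_0)\wedge\bigwedge_{j=1}^{\ell}\mathrm{Inf}(c_j)$. Then there exists a Büchi automaton accepting $\Sigma^\omega\setminus\mathcal{L}(\mathcal{A})$ with $O(\ell^n\cdot\mathrm{tight}(n+1))$ states; using the known estimate $\mathrm{tight}(n)\approx(0.76n)^n$, this is $O(n\ell^n(0.76n)^n)$ states.
   Context: A (transition-based) Emerson–Lei automaton over finite $\Sigma$ is $(Q,\delta,I,\Gamma,p,\mathit{Acc})$ with finite states $Q$, $\delta\subseteq Q\times\Sigma\times Q$, $I\subseteq Q$, colours $\Gamma$, colouring $p:\delta\to2^\Gamma$ and $\mathit{Acc}$ a $\wedge/\vee$-combination of atoms $\mathrm{Inf}(c),\mathrm{Fin}(c)$; a run is accepting iff the set $M$ of colours on transitions occurring infinitely often satisfies $\mathit{Acc}$ ($\mathrm{Inf}(c)$ iff $c\in M$, $\mathrm{Fin}(c)$ iff $c\notin M$); the language consists of words with an accepting run from an initial state. A Büchi automaton has acceptance condition $\mathrm{Inf}(0)$. $\mathrm{tight}(n)$ is the number of functions $f:\{1,\dots,n\}\to\omega$ whose maximum $r$ is odd and whose image contains $\{1,3,\dots,r\}$. -}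

module Defs where

open import Data.Nat using (ℕ; zero; suc; _+_; _*_; _≤_; _<_; _⊔_; _≡ᵇ_)
open import Data.Bool using (Bool; true; false; _∧_; not)
open import Data.Fin using (Fin)
open import Data.List using (List; []; _∷_; map; concatMap; upTo; filterᵇ; length; foldl)
open import Data.Bool.ListAction using (any; all)
open import Data.List using () renaming (allFin to allFinL)
open import Data.Vec using (Vec; []; _∷_; toList)
open import Data.Product using (Σ; ∃; _×_)
open import Data.Empty using (⊥)
open import Relation.Binary.PropositionalEquality using (_≡_)

isOdd : ℕ → Bool
isOdd zero = false
isOdd (suc n) = not (isOdd n)

maxV : ∀ {n} → Vec ℕ n → ℕ
maxV [] = 0
maxV (x ∷ v) = x ⊔ maxV v

isTight : ∀ {n} → Vec ℕ n → Bool
isTight v = isOdd (maxV v) ∧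
  all (λ j → not (isOdd j) Data.Bool.∨ any (λ x → x ≡ᵇ j) (toList v))
      (upTo (suc (maxV v)))

allVecs : (n m : ℕ) → List (Vec ℕ n)
allVecs zero m = [] ∷ []
allVecs (suc n) m = concatMap (λ x → map (x ∷_) (allVecs n m)) (upTo m)

-- Every tight f : {1..n} → ω has all values ≤ its maximum r ≤ 2n-1
-- (the odd numbers 1,3,..,r are pairwise distinct values of f),
-- so counting tight functions with values < 2n counts all of them.
tight : ℕ → ℕ
tight n = length (filterᵇ isTight (allVecs n (2 * n)))

data AccCond (Γ : ℕ) : Set where
  Inf  : Fin Γ → AccCond Γ
  Fin′ : Fin Γ → AccCond Γ
  _and_ : AccCond Γ → AccCond Γ → AccCond Γ
  _or_  : AccCond Γ → AccCond Γ → AccCond Γ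

Sat : ∀ {Γ} → AccCond Γ → (Fin Γ → Set) → Set
Sat (Inf c) M = M c
Sat (Fin′ c) M = M c → ⊥
Sat (a and b) M = Sat a M × Sat b M
Sat (a or b) M = Sat a M Data.Sum.⊎ Sat b M
  where import Data.Sum

record ELA (k Γ : ℕ) : Set where
  field
    nStates : ℕ
    trans   : Fin nStates → Fin k → Fin nStates → Bool
    init    : Fin nStates → Bool
    colour  : Fin nStates → Fin k → Fin nStates → Fin Γ → Bool
    acc     : AccCond Γ

Word : ℕ → Set
Word k = ℕ → Fin k

module _ {k Γ : ℕ} (A : ELA k Γ) where
  open ELA A

  record Run (w : Word k) : Set where
    field
      st    : ℕ → Fin nStates
      start : init (st 0) ≡ true
      step  : ∀ i → trans (st i) (w i) (st (suc i)) ≡ true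

  InfOften : {w : Word k} → Run w → Fin Γ → Set
  InfOften {w} ρ c = ∀ N → ∃ λ i → N ≤ i × colour (st i) (w i) (st (suc i)) c ≡ true
    where open Run ρ

  Accepts : Word k → Set
  Accepts w = Σ (Run w) λ ρ → Sat acc (InfOften ρ)

buchiAcc : AccCond 1
buchiAcc = Inf Data.Fin.zero

genRabinAcc : (ℓ : ℕ) → AccCond (suc ℓ)
genRabinAcc ℓ = foldl _and_ (Fin′ Data.Fin.zero) (map (λ j → Inf (Data.Fin.suc j)) (allFinL ℓ))

-- Rank-based complementation in the style of Kupferman and Vardi, with a Miyano–Hayashi
-- breakpoint.  Restrict the run DAG of A on w to the arcs avoiding c₀ and peel it in stages:
-- even stages drop the vertices with only finite futures, odd stages drop the free vertices,
-- from which some Inf-colour can no longer be reached inside the current stage.  If A rejects w,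
-- stage 2n+1 is empty (a stage without free vertices yields an accepting run), so all ranks are
-- at most 2m for some m ≤ n, and from some level on every odd rank below 2m occurs.  The Büchi
-- automaton B guesses such a level ranking f, a breakpoint set O of states of the even rank i
-- under inspection, and for each state the index J of an Inf-colour avoided by its odd-rank
-- paths; it accepts whenever O empties.  Conversely, along an accepting run of A the guessed rank
-- eventually stays constant: if it is odd, J stabilises on a colour the run never sees again;
-- if it is even, O never empties.  Since all odd ranks are present, (f, O, i) is stored as a
-- tight function on n+1 points (shifted as recorded in one of four tags) and J as one of ℓⁿ
-- functions, so B has 5·ℓⁿ·tight(n+1) states.

module Submission where

open import Defs
open import Axiom.ExcludedMiddle using (ExcludedMiddle)
open import Level using (0ℓ)
open import Axiom.DoubleNegationElimination using (em⇒dne)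
open import Data.Nat using (ℕ; zero; suc; _+_; _*_; _∸_; _^_; _≤_; _<_; _⊔_; z≤n; s≤s; _≤?_; _<?_; _≡ᵇ_; _≟_)
open import Data.Nat.Properties
open import Data.Nat.Tactic.RingSolver using (solve-∀)
open import Data.Nat.DivMod using ([m+kn]%n≡m%n; m<n⇒m%n≡m; m%n<n)
open import Data.Bool using (Bool; true; false; not; _∧_; _∨_; T)
open import Data.Bool.Properties using (T?; ¬-not; ∨-zeroʳ)
open import Data.Bool.ListAction using (any; all)
open import Data.Fin using (Fin; toℕ; fromℕ<; remQuot; combine; finToFun; funToFin) renaming (zero to fz; suc to fs)
import Data.Fin.Properties as FP
open import Data.Maybe using (Maybe; just; nothing)
import Data.Maybe.Properties as MP
open import Data.List using (List; []; _∷_; map; upTo; filterᵇ; foldl) renaming (allFin to allFinL)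
import Data.List as List
open import Data.List.Relation.Unary.All as All using (All; []; _∷_)
import Data.List.Relation.Unary.All.Properties as AllP
open import Data.List.Relation.Unary.Any using (here; there; index)
open import Data.List.Relation.Unary.Any.Properties using (lookup-index)
open import Data.List.Membership.Propositional using (_∈_; lose)
open import Data.List.Membership.Propositional.Properties using (∈-map⁺; ∈-concatMap⁺; ∈-upTo⁺; ∈-upTo⁻; ∈-filter⁺; ∈-allFin)
open import Data.Vec using (Vec; []; _∷_; toList; lookup; tabulate)
open import Data.Vec.Properties using (lookup∘tabulate)
open import Data.Product using (Σ; ∃; _×_; _,_; proj₁; proj₂)
open import Data.Sum using (_⊎_; inj₁; inj₂)
open import Data.Empty using (⊥; ⊥-elim)
open import Data.Unit using (⊤; tt)
open import Function.Bundles using (_⇔_; mk⇔)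
open import Relation.Binary.PropositionalEquality hiding (J)
open import Relation.Binary.Definitions using (Tri; tri<; tri≈; tri>)
open import Relation.Nullary using (¬_; Dec; yes; no; does)

HasEntry : ∀ {N} → Vec ℕ N → ℕ → Set
HasEntry v x = Σ _ λ p → lookup v p ≡ x

maxV-≤ : ∀ {N} (v : Vec ℕ N) M → (∀ p → lookup v p ≤ M) → maxV v ≤ M
maxV-≤ [] M h = z≤n
maxV-≤ (x ∷ v) M h = ⊔-lub (h fz) (maxV-≤ v M (λ p → h (fs p)))

≤-maxV : ∀ {N} (v : Vec ℕ N) p → lookup v p ≤ maxV v
≤-maxV (x ∷ v) fz = m≤m⊔n x (maxV v)
≤-maxV (x ∷ v) (fs p) = ≤-trans (≤-maxV v p) (m≤n⊔m x (maxV v))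

all-intro : ∀ {A : Set} (p : A → Bool) xs → (∀ x → x ∈ xs → p x ≡ true) → all p xs ≡ true
all-intro p [] h = refl
all-intro p (x ∷ xs) h rewrite h x (here refl) = all-intro p xs (λ y m → h y (there m))

any-intro : ∀ {A : Set} (p : A → Bool) {x} xs → x ∈ xs → p x ≡ true → any p xs ≡ true
any-intro p (y ∷ xs) (here refl) e rewrite e = refl
any-intro p (y ∷ xs) (there m) e rewrite any-intro p xs m e = ∨-zeroʳ (p y)

lookup∈toList : ∀ {N} (v : Vec ℕ N) p → lookup v p ∈ toList v
lookup∈toList (x ∷ v) fz = here refl
lookup∈toList (x ∷ v) (fs p) = there (lookup∈toList v p)

≡ᵇ-refl : ∀ n → (n ≡ᵇ n) ≡ true
≡ᵇ-refl zero = refl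
≡ᵇ-refl (suc n) = ≡ᵇ-refl n

isTight-intro : ∀ {N} (v : Vec ℕ N) M → (∀ p → lookup v p ≤ M) → HasEntry v M → isOdd M ≡ true →
  (∀ o → o ≤ M → isOdd o ≡ true → HasEntry v o) → isTight v ≡ true
isTight-intro v M ub (p , ep) oM odds
  with maxV v | ≤-antisym (maxV-≤ v M ub) (subst (_≤ maxV v) ep (≤-maxV v p))
... | .M | refl rewrite oM = all-intro _ (upTo (suc M)) λ j jm → odd-present j (∈-upTo⁻ jm)
  where
  odd-present : ∀ j → j < suc M → (not (isOdd j) ∨ any (λ x → x ≡ᵇ j) (toList v)) ≡ true
  odd-present j (s≤s j≤M) with isOdd j in eo
  ... | false = refl
  ... | true with odds j j≤M eo
  ... | (q , eq) = any-intro _ (toList v) (lookup∈toList v q) (subst (λ z → (z ≡ᵇ j) ≡ true) (sym eq) (≡ᵇ-refl j))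

oddEntries<length : ∀ {N} (v : Vec ℕ N) h → (∀ k → k ≤ h → HasEntry v (suc (2 * k))) → h < N
oddEntries<length {N} v h ent with h <? N
... | yes h<N = h<N
... | no h≮N with FP.pigeonhole (s≤s (≮⇒≥ h≮N)) position
  where
  position : Fin (suc h) → Fin N
  position k = proj₁ (ent (toℕ k) (FP.toℕ≤pred[n] k))
... | (i , j , i<j , eq) = ⊥-elim (<-irrefl i≡j i<j)
  where
  same-entry : suc (2 * toℕ i) ≡ suc (2 * toℕ j)
  same-entry = trans (sym (proj₂ (ent (toℕ i) (FP.toℕ≤pred[n] i))))
        (trans (cong (lookup v) eq) (proj₂ (ent (toℕ j) (FP.toℕ≤pred[n] j))))
  i≡j : toℕ i ≡ toℕ j
  i≡j = *-cancelˡ-≡ (toℕ i) (toℕ j) 2 (suc-injective same-entry)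

∈-allVecs : ∀ N m (v : Vec ℕ N) → (∀ p → lookup v p < m) → v ∈ allVecs N m
∈-allVecs zero m [] h = here refl
∈-allVecs (suc N) m (x ∷ v) h =
  ∈-concatMap⁺ (λ y → map (y ∷_) (allVecs N m))
    (lose {P = λ y → (x ∷ v) ∈ map (y ∷_) (allVecs N m)} (∈-upTo⁺ (h fz))
      (∈-map⁺ (x ∷_) (∈-allVecs N m v (λ p → h (fs p)))))

-- `tight N` is by definition the length of this list, so `Fin (tight N)` indexes the tight vectors.
tightVecs : (N : ℕ) → List (Vec ℕ N)
tightVecs N = filterᵇ isTight (allVecs N (2 * N))

∈-tightVecs : ∀ N (v : Vec ℕ N) → (∀ p → lookup v p < 2 * N) → isTight v ≡ true → v ∈ tightVecs N
∈-tightVecs N v b t = ∈-filter⁺ (λ x → T? (isTight x)) (∈-allVecs N (2 * N) v b) (subst T (sym t) _)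

tightVecs-index : ∀ N (v : Vec ℕ N) → (∀ p → lookup v p < 2 * N) → isTight v ≡ true →
  Σ (Fin (tight N)) λ ix → List.lookup (tightVecs N) ix ≡ v
tightVecs-index N v b t = index m , sym (lookup-index m)
  where m = ∈-tightVecs N v b t

isOdd-+-self : ∀ h → isOdd (h + h) ≡ false
isOdd-+-self zero = refl
isOdd-+-self (suc h) = trans (cong (λ z → not (isOdd z)) (+-suc h h)) (cong (λ b → not (not b)) (isOdd-+-self h))

isOdd-2* : ∀ h → isOdd (2 * h) ≡ false
isOdd-2* h = trans (cong isOdd (cong (h +_) (+-identityʳ h))) (isOdd-+-self h)

parity : ∀ e → (isOdd e ≡ false × ∃ λ h → e ≡ 2 * h) ⊎ (isOdd e ≡ true × ∃ λ h → e ≡ suc (2 * h))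
parity zero = inj₁ (refl , 0 , refl)
parity (suc e) with parity e
... | inj₁ (o , h , eq) = inj₂ (cong not o , h , cong suc eq)
... | inj₂ (o , h , eq) = inj₁ (cong not o , suc h , trans (cong suc eq) (cong suc (sym (+-suc h (h + 0)))))

odd⇒1+2* : ∀ {o} → isOdd o ≡ true → ∃ λ h → o ≡ suc (2 * h)
odd⇒1+2* {o} oo with parity o
... | inj₂ (_ , odd) = odd
... | inj₁ (ev , _) with trans (sym oo) ev
... | ()

odd≢even : ∀ a c → suc (2 * a) ≢ 2 * c
odd≢even a c e with trans (trans (sym (cong not (isOdd-2* a))) (cong isOdd e)) (isOdd-2* c)
... | ()

Often : (ℕ → Set) → Set
Often P = ∀ N → ∃ λ u → N ≤ u × P u

Often-map : ∀ {P R : ℕ → Set} → (∀ {u} → P u → R u) → Often P → Often R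
Often-map f often N with often N
... | u , le , pu = u , le , f pu

Often-shift : ∀ {P : ℕ → Set} T → Often P → Often λ u → P (u + T)
Often-shift {P} T h N with h (N + T)
... | u , le , pu = u ∸ T , ≤-trans (≤-reflexive (sym (m+n∸n≡m N T))) (∸-monoˡ-≤ T le) ,
        subst P (sym (m∸n+n≡m (≤-trans (m≤n+m T N) le))) pu

Sat-foldl-and⁻ : ∀ {Γ} (M : Fin Γ → Set) a xs → Sat (foldl _and_ a xs) M → Sat a M × All (λ c → Sat c M) xs
Sat-foldl-and⁻ M a [] s = s , []
Sat-foldl-and⁻ M a (x ∷ xs) s with Sat-foldl-and⁻ M (a and x) xs s
... | (sa , sx) , rest = sa , (sx ∷ rest)

Sat-foldl-and⁺ : ∀ {Γ} (M : Fin Γ → Set) a xs → Sat a M → All (λ c → Sat c M) xs → Sat (foldl _and_ a xs) M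
Sat-foldl-and⁺ M a [] s [] = s
Sat-foldl-and⁺ M a (x ∷ xs) s (px ∷ pxs) = Sat-foldl-and⁺ M (a and x) xs (s , px) pxs

Sat-genRabin⁻ : ∀ ℓ (M : Fin (suc ℓ) → Set) → Sat (genRabinAcc ℓ) M → (M fz → ⊥) × (∀ j → M (fs j))
Sat-genRabin⁻ ℓ M s with Sat-foldl-and⁻ M (Fin′ fz) (map (λ j → Inf (fs j)) (allFinL ℓ)) s
... | nf , al = nf , λ j → All.lookup (AllP.map⁻ al) (∈-allFin j)

Sat-genRabin⁺ : ∀ ℓ (M : Fin (suc ℓ) → Set) → (M fz → ⊥) → (∀ j → M (fs j)) → Sat (genRabinAcc ℓ) M
Sat-genRabin⁺ ℓ M nf al = Sat-foldl-and⁺ M (Fin′ fz) (map (λ j → Inf (fs j)) (allFinL ℓ)) nf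
  (AllP.map⁺ (All.tabulate (λ {j} _ → al j)))

antitone-≤₀ : (g : ℕ → ℕ) → (∀ u → g (suc u) ≤ g u) → ∀ u → g u ≤ g 0
antitone-≤₀ g h zero = ≤-refl
antitone-≤₀ g h (suc u) = ≤-trans (h u) (antitone-≤₀ g h u)

maxᶠ : ∀ {m} → (Fin m → ℕ) → ℕ
maxᶠ {zero} f = 0
maxᶠ {suc m} f = f fz ⊔ maxᶠ (λ x → f (fs x))

≤-maxᶠ : ∀ {m} (f : Fin m → ℕ) x → f x ≤ maxᶠ f
≤-maxᶠ f fz = m≤m⊔n _ _
≤-maxᶠ f (fs x) = ≤-trans (≤-maxᶠ (λ y → f (fs y)) x) (m≤n⊔m _ _)

maxᶠ-≤ : ∀ {m} (f : Fin m → ℕ) {B} → (∀ x → f x ≤ B) → maxᶠ f ≤ B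
maxᶠ-≤ {zero} f h = z≤n
maxᶠ-≤ {suc m} f h = ⊔-lub (h fz) (maxᶠ-≤ (λ x → f (fs x)) (λ x → h (fs x)))

maxᶠ-cong : ∀ {m} {f g : Fin m → ℕ} → (∀ x → f x ≡ g x) → maxᶠ f ≡ maxᶠ g
maxᶠ-cong {zero} h = refl
maxᶠ-cong {suc m} h = cong₂ _⊔_ (h fz) (maxᶠ-cong (λ x → h (fs x)))

leastTrue : ∀ {a} → (Fin (suc a) → Bool) → Fin (suc a)
leastTrue {zero} p = fz
leastTrue {suc a} p with p fz
... | true = fz
... | false = fs (leastTrue (λ j → p (fs j)))

leastTrue-spec : ∀ {a} (p : Fin (suc a) → Bool) j → p j ≡ true → p (leastTrue p) ≡ true × toℕ (leastTrue p) ≤ toℕ j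
leastTrue-spec {zero} p fz e = e , z≤n
leastTrue-spec {suc a} p j e with p fz in e0
... | true = e0 , z≤n
leastTrue-spec {suc a} p fz e | false with trans (sym e0) e
... | ()
leastTrue-spec {suc a} p (fs j) e | false with leastTrue-spec (λ j → p (fs j)) j e
... | e1 , le = e1 , s≤s le

module Classical (em : ExcludedMiddle 0ℓ) where

  holds : Set → Bool
  holds P = does (em {P})

  holds⇒ : ∀ {P} → holds P ≡ true → P
  holds⇒ {P} e with em {P}
  ... | yes p = p
  holds⇒ {P} () | no _

  ⇒holds : ∀ {P} → P → holds P ≡ true
  ⇒holds {P} p with em {P}
  ... | yes _ = refl
  ... | no ¬p = ⊥-elim (¬p p)

  dne : ∀ {P : Set} → ¬ ¬ P → P
  dne = em⇒dne em

  ¬∀⇒∃¬ : ∀ {I : Set} {P : I → Set} → ¬ (∀ x → P x) → ∃ λ x → ¬ P x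
  ¬∀⇒∃¬ h = dne (λ ¬∃ → h (λ x → dne (λ ¬Px → ¬∃ (x , ¬Px))))

  antitone-stabilises : ∀ v (g : ℕ → ℕ) → g 0 ≤ v → (∀ u → g (suc u) ≤ g u) → ∃ λ T → ∀ u → g (u + T) ≡ g T
  antitone-stabilises v g le h with em {∀ u → g u ≡ g 0}
  ... | yes all = 0 , λ u → trans (cong g (+-identityʳ u)) (all u)
  antitone-stabilises zero g le h | no nall with ¬∀⇒∃¬ nall
  ... | u , ne = ⊥-elim (ne (trans (≤-antisym (≤-trans (antitone-≤₀ g h u) le) z≤n) (sym (≤-antisym le z≤n))))
  antitone-stabilises (suc v) g le h | no nall with ¬∀⇒∃¬ nall
  ... | u , ne with antitone-stabilises v (λ x → g (x + u)) (≤-pred (≤-trans (≤∧≢⇒< (antitone-≤₀ g h u) ne) le)) (λ x → h (x + u))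
  ... | T , eq = T + u , λ x → trans (cong g (sym (+-assoc x T u))) (eq x)

  pigeonhole-unbounded : ∀ {m} (P : Fin m → ℕ → Set) → (∀ d → ∃ λ q → P q d) → (∀ q d d' → d ≤ d' → P q d' → P q d) → ∃ λ q → ∀ d → P q d
  pigeonhole-unbounded {m} P ex anti = dne λ nall →
    let bounded : Fin m → ℕ
        bounded q = proj₁ (¬∀⇒∃¬ (λ a → nall (q , a)))
        D = maxᶠ bounded
        q0 = proj₁ (ex D)
    in proj₂ (¬∀⇒∃¬ (λ a → nall (q0 , a))) (anti q0 _ D (≤-maxᶠ bounded q0) (proj₂ (ex D)))

module States (em : ExcludedMiddle 0ℓ) {k ℓ' : ℕ} (A : ELA k (suc (suc ℓ'))) where

  open ELA A public renaming (nStates to n; trans to tr; init to ini; colour to col; acc to accA)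

  L : ℕ
  L = suc ℓ'

  Q : Set
  Q = Fin n

  open Classical em public

  orZero : Maybe ℕ → ℕ
  orZero nothing = 0
  orZero (just r) = r

  maxRank : ∀ {m} → (Fin m → Maybe ℕ) → ℕ
  maxRank f = maxᶠ (λ q → orZero (f q))

  ≤-maxRank : ∀ {m} (f : Fin m → Maybe ℕ) q r → f q ≡ just r → r ≤ maxRank f
  ≤-maxRank f q r e = subst (_≤ maxRank f) (cong orZero e) (≤-maxᶠ _ q)

  maxRank-≤ : ∀ {m} (f : Fin m → Maybe ℕ) B → (∀ q r → f q ≡ just r → r ≤ B) → maxRank f ≤ B
  maxRank-≤ f B h = maxᶠ-≤ _ (λ q → orZero-≤ (f q) (h q))
    where
    orZero-≤ : ∀ x → (∀ r → x ≡ just r → r ≤ B) → orZero x ≤ B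
    orZero-≤ nothing _ = z≤n
    orZero-≤ (just r) h = h r refl

  nextEven : ℕ → (Q → Maybe ℕ) → ℕ
  nextEven i f with i + 2 ≤? maxRank f
  ... | yes _ = i + 2
  ... | no _ = 0

  nextEven-≡ : ∀ i f → i + 2 ≤ maxRank f → nextEven i f ≡ i + 2
  nextEven-≡ i f le with i + 2 ≤? maxRank f
  ... | yes _ = refl
  ... | no nle = ⊥-elim (nle le)

  nextEven-cases : ∀ i f → (nextEven i f ≡ i + 2 × i + 2 ≤ maxRank f) ⊎ nextEven i f ≡ 0
  nextEven-cases i f with i + 2 ≤? maxRank f
  ... | yes le = inj₁ (refl , le)
  ... | no _ = inj₂ refl

  rankCap : ℕ
  rankCap = 2 * n + 2

  -- `subset S` is the initial subset-construction phase.  In `ranked f O i J`, f is the guessed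
  -- level ranking (`nothing` off the current level), O the breakpoint set of states of the even
  -- rank i under inspection, and J q indexes an Inf-colour avoided by the odd-rank paths from q.
  data State : Set where
    subset : (Q → Bool) → State
    ranked : (Q → Maybe ℕ) → (Q → Bool) → ℕ → (Q → Fin L) → State

  rankOf : State → Q → Maybe ℕ
  rankOf (subset _) _ = nothing
  rankOf (ranked f O i J) = f

  breakpoint : State → Q → Bool
  breakpoint (subset _) _ = false
  breakpoint (ranked f O i J) = O

  checkedRank : State → ℕ
  checkedRank (subset _) = 0
  checkedRank (ranked f O i J) = i

  colourIndex : State → Q → Fin L
  colourIndex (subset _) _ = fz
  colourIndex (ranked f O i J) = J

  SafeEdge : Fin k → Q → Q → Set
  SafeEdge a q q' = tr q a q' ≡ true × col q a q' fz ≡ false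

  IsEmpty : (Q → Bool) → Set
  IsEmpty O = ∀ q → O q ≡ false

  record RankedStep (a : Fin k) (s s' : State) : Set where
    field
      covers : ∀ q q' r → rankOf s q ≡ just r → tr q a q' ≡ true → ∃ λ r' → rankOf s' q' ≡ just r'
      antitone : ∀ q q' r r' → rankOf s q ≡ just r → rankOf s' q' ≡ just r' → SafeEdge a q q' → r' ≤ r
      odd-colour : ∀ q q' r → rankOf s q ≡ just r → rankOf s' q' ≡ just r → SafeEdge a q q' → isOdd r ≡ true →
               (toℕ (colourIndex s' q') ≤ toℕ (colourIndex s q)) × col q a q' (fs (colourIndex s q)) ≡ false
      on-empty : IsEmpty (breakpoint s) → (checkedRank s' ≡ nextEven (checkedRank s) (rankOf s')) ×
               (∀ q' → rankOf s' q' ≡ just (checkedRank s') → breakpoint s' q' ≡ true)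
      on-nonempty : ¬ IsEmpty (breakpoint s) → (checkedRank s' ≡ checkedRank s) ×
               (∀ q q' → breakpoint s q ≡ true → SafeEdge a q q' → rankOf s' q' ≡ just (checkedRank s) → breakpoint s' q' ≡ true)
      bounded : ∀ q r → rankOf s' q ≡ just r → r ≤ rankCap

  Step : Fin k → State → State → Set
  Step a (subset S) (subset S') = ∀ q q' → S q ≡ true → tr q a q' ≡ true → S' q' ≡ true
  Step a (subset S) (ranked f' O' i' J') =
    (∀ q q' → S q ≡ true → tr q a q' ≡ true → ∃ λ r' → f' q' ≡ just r') × (∀ q r → f' q ≡ just r → r ≤ rankCap)
  Step a (ranked _ _ _ _) (subset _) = ⊥
  Step a (ranked f O i J) (ranked f' O' i' J') = RankedStep a (ranked f O i J) (ranked f' O' i' J')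

  Initial : State → Set
  Initial (subset S) = ∀ q → ini q ≡ true → S q ≡ true
  Initial (ranked _ _ _ _) = ⊥

  Accepting : State → Set
  Accepting (subset _) = ⊥
  Accepting (ranked f O i J) = IsEmpty O

  IsRanked : State → Set
  IsRanked (subset _) = ⊥
  IsRanked (ranked _ _ _ _) = ⊤

  Tracks : State → Q → Set
  Tracks (subset S) q = S q ≡ true
  Tracks (ranked f O i J) q = ∃ λ r → f q ≡ just r

  tracks-step : ∀ a s s' q q' → Step a s s' → Tracks s q → tr q a q' ≡ true → Tracks s' q'
  tracks-step a (subset S) (subset S') q q' st d t = st q q' d t
  tracks-step a (subset S) (ranked _ _ _ _) q q' st d t = proj₁ st q q' d t
  tracks-step a (ranked _ _ _ _) (subset _) q q' () d t
  tracks-step a (ranked f O i J) (ranked f' O' i' J') q q' st (r , e) t = RankedStep.covers st q q' r e t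

  isRanked-step : ∀ a s s' → Step a s s' → IsRanked s → IsRanked s'
  isRanked-step a (ranked _ _ _ _) (subset _) () _
  isRanked-step a (ranked _ _ _ _) (ranked _ _ _ _) _ _ = tt

  rankedStep : ∀ a s s' → Step a s s' → IsRanked s → RankedStep a s s'
  rankedStep a (ranked _ _ _ _) (subset _) () _
  rankedStep a (ranked _ _ _ _) (ranked _ _ _ _) st _ = st

  accepting⇒ranked : ∀ s → Accepting s → IsRanked s
  accepting⇒ranked (ranked _ _ _ _) _ = tt

  accepting⇒empty : ∀ s → Accepting s → IsEmpty (breakpoint s)
  accepting⇒empty (ranked _ _ _ _) e = e

  tracked⇒ranked : ∀ s q → IsRanked s → Tracks s q → ∃ λ r → rankOf s q ≡ just r
  tracked⇒ranked (ranked _ _ _ _) q _ d = d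

  WellFormed : State → Set
  WellFormed (subset S) = ⊤
  WellFormed (ranked f O i J) = Σ ℕ λ m → (∃ λ h → i ≡ 2 * h) × i ≤ 2 * m × (∀ q r → f q ≡ just r → r ≤ 2 * m) ×
    (∀ h → h < m → ∃ λ q → f q ≡ just (suc (2 * h))) × (∀ q → O q ≡ true → f q ≡ just i)

module Soundness (em : ExcludedMiddle 0ℓ) {k ℓ' : ℕ} (A : ELA k (suc (suc ℓ'))) where

  open States em A

  record Conflict : Set where
    field
      s : ℕ → State
      p : ℕ → Q
      a : ℕ → Fin k
      allRanked : ∀ u → IsRanked (s u)
      steps : ∀ u → Step (a u) (s u) (s (suc u))
      safe : ∀ u → SafeEdge (a u) (p u) (p (suc u))
      tracked : ∀ u → Tracks (s u) (p u)
      colours-often : ∀ j → Often λ u → col (p u) (a u) (p (suc u)) (fs j) ≡ true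
      accepting-often : Often λ u → Accepting (s u)

  Conflict-shift : Conflict → ℕ → Conflict
  Conflict-shift c T = record
    { s = λ u → s (u + T) ; p = λ u → p (u + T) ; a = λ u → a (u + T)
    ; allRanked = λ u → allRanked (u + T) ; steps = λ u → steps (u + T) ; safe = λ u → safe (u + T)
    ; tracked = λ u → tracked (u + T)
    ; colours-often = λ j → Often-shift {λ u → col (p u) (a u) (p (suc u)) (fs j) ≡ true} T (colours-often j)
    ; accepting-often = Often-shift {λ u → Accepting (s u)} T accepting-often }
    where open Conflict c

  module ConflictRanks (c : Conflict) where
    open Conflict c

    rank-p : ∀ u → rankOf (s u) (p u) ≡ just (orZero (rankOf (s u) (p u)))
    rank-p u with tracked⇒ranked (s u) (p u) (allRanked u) (tracked u)
    ... | r , e = trans e (cong just (cong orZero (sym e)))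

    rstep : ∀ u → RankedStep (a u) (s u) (s (suc u))
    rstep u = rankedStep _ _ _ (steps u) (allRanked u)

    rank-p-antitone : ∀ u → orZero (rankOf (s (suc u)) (p (suc u))) ≤ orZero (rankOf (s u) (p u))
    rank-p-antitone u = RankedStep.antitone (rstep u) (p u) (p (suc u)) _ _ (rank-p u) (rank-p (suc u)) (safe u)

  module ConstantRank (c : Conflict) (e : ℕ) (ce : ∀ u → rankOf (Conflict.s c u) (Conflict.p c u) ≡ just e) where
    open Conflict c
    open ConflictRanks c

    -- The colour index along p cannot increase, so it stabilises on some j; but from then on p
    -- never sees colour j + 1, which A's run sees infinitely often.
    oddCase : isOdd e ≡ true → ⊥
    oddCase oe with antitone-stabilises _ (λ u → toℕ (colourIndex (s u) (p u))) ≤-refl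
                     (λ u → proj₁ (RankedStep.odd-colour (rstep u) (p u) (p (suc u)) e (ce u) (ce (suc u)) (safe u) oe))
    ... | T , eqJ with colours-often (colourIndex (s T) (p T)) T
    ... | u , le , ct = noc
      where
      u' = u ∸ T
      uu : u' + T ≡ u
      uu = m∸n+n≡m le
      jeq : colourIndex (s u) (p u) ≡ colourIndex (s T) (p T)
      jeq = FP.toℕ-injective (subst (λ z → toℕ (colourIndex (s z) (p z)) ≡ toℕ (colourIndex (s T) (p T))) uu (eqJ u'))
      cf : col (p u) (a u) (p (suc u)) (fs (colourIndex (s u) (p u))) ≡ false
      cf = proj₂ (RankedStep.odd-colour (rstep u) (p u) (p (suc u)) e (ce u) (ce (suc u)) (safe u) oe)
      noc : ⊥
      noc with trans (sym ct) (subst (λ j → col (p u) (a u) (p (suc u)) (fs j) ≡ false) jeq cf)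
      ... | ()

    checked : ℕ → ℕ
    checked u = checkedRank (s u)

    maxRank≤cap : ∀ u → maxRank (rankOf (s (suc u))) ≤ rankCap
    maxRank≤cap u = maxRank-≤ _ rankCap (RankedStep.bounded (rstep u))

    e≤maxRank : ∀ u → e ≤ maxRank (rankOf (s u))
    e≤maxRank u = ≤-maxRank (rankOf (s u)) (p u) e (ce u)

    next-empty′ : ∀ d u → IsEmpty (breakpoint (s (d + u))) → ∃ λ t → IsEmpty (breakpoint (s t)) × checked (suc t) ≡ nextEven (checked u) (rankOf (s (suc t)))
    next-empty′ d u emp with em {IsEmpty (breakpoint (s u))}
    ... | yes eu = u , eu , proj₁ (RankedStep.on-empty (rstep u) eu)
    next-empty′ zero u emp | no ne = ⊥-elim (ne emp)
    next-empty′ (suc d) u emp | no ne with next-empty′ d (suc u) (subst (λ z → IsEmpty (breakpoint (s z))) (sym (+-suc d u)) emp)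
    ... | t , et , eq = t , et , trans eq (cong (λ z → nextEven z (rankOf (s (suc t)))) (proj₁ (RankedStep.on-nonempty (rstep u) ne)))

    next-empty : ∀ u → ∃ λ t → IsEmpty (breakpoint (s t)) × checked (suc t) ≡ nextEven (checked u) (rankOf (s (suc t)))
    next-empty u with accepting-often u
    ... | t3 , le , ac = next-empty′ (t3 ∸ u) u (subst (λ z → IsEmpty (breakpoint (s z))) (sym (m∸n+n≡m le)) (accepting⇒empty _ ac))

    EmptyBeforeCheck : Set
    EmptyBeforeCheck = ∃ λ t → IsEmpty (breakpoint (s t)) × checked (suc t) ≡ e

    climb : ∀ d u → checked u + 2 * suc d ≡ e → EmptyBeforeCheck
    climb d u eq with next-empty u
    ... | t , et , nx = goal d refl
      where
      le2 : checked u + 2 ≤ e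
      le2 = subst (checked u + 2 ≤_) eq (+-monoʳ-≤ (checked u) (*-monoʳ-≤ 2 (s≤s z≤n)))
      nx2 : checked (suc t) ≡ checked u + 2
      nx2 = trans nx (nextEven-≡ (checked u) (rankOf (s (suc t))) (≤-trans le2 (e≤maxRank (suc t))))
      goal : ∀ d' → d' ≡ d → EmptyBeforeCheck
      goal zero refl = t , et , trans nx2 (trans (cong (checked u +_) refl) eq)
      goal (suc d') refl = climb d' (suc t) (trans (cong (_+ 2 * suc d') nx2) (trans (+-assoc (checked u) 2 (2 * suc d'))
                            (trans (cong (checked u +_) (sym (*-distribˡ-+ 2 1 (suc d')))) eq)))

    from-zero : ∀ t → IsEmpty (breakpoint (s t)) → checked (suc t) ≡ 0 → isOdd e ≡ false → EmptyBeforeCheck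
    from-zero t et z oe with parity e
    ... | inj₂ (o , _) with trans (sym oe) o
    ... | ()
    from-zero t et z oe | inj₁ (_ , zero , eq) = t , et , trans z (sym (trans eq refl))
    from-zero t et z oe | inj₁ (_ , suc d , eq) = climb d (suc t) (trans (cong (_+ 2 * suc d) z) (sym eq))

    wraps-to-zero : ∀ d u → rankCap < checked u + d → ∃ λ t → IsEmpty (breakpoint (s t)) × checked (suc t) ≡ 0
    wraps-to-zero d u lt with next-empty u
    ... | t , et , nx with nextEven-cases (checked u) (rankOf (s (suc t)))
    ... | inj₂ z = t , et , trans nx z
    ... | inj₁ (eq , le) with ≤-trans le (maxRank≤cap t)
    wraps-to-zero zero u lt | t , et , nx | inj₁ (eq , le) | le' =
      ⊥-elim (<-irrefl refl (<-≤-trans lt (≤-trans (+-monoʳ-≤ (checked u) {0} {2} z≤n) le')))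
    wraps-to-zero (suc d) u lt | t , et , nx | inj₁ (eq , le) | le' =
      wraps-to-zero d (suc t) (<-≤-trans lt (≤-trans (+-monoʳ-≤ (checked u) (n≤1+n (suc d)))
        (≤-reflexive (trans (sym (+-assoc (checked u) 2 d)) (cong (_+ d) (sym (trans nx eq)))))))

    -- The inspected rank cycles through the even ranks up to the maximum, so at some point it is e
    -- and p enters the breakpoint set; p then stays in it and the set never empties again.
    evenCase : isOdd e ≡ false → ⊥
    evenCase oe with wraps-to-zero (suc rankCap) 0 (m≤n+m (suc rankCap) (checked 0))
    ... | t0 , et0 , z0 with from-zero t0 et0 z0 oe
    ... | t , et , ie = contra
      where
      P : ℕ → Set
      P u = breakpoint (s u) (p u) ≡ true × checked u ≡ e
      P1 : P (suc t)
      P1 = proj₂ (RankedStep.on-empty (rstep t) et) (p (suc t)) (trans (ce (suc t)) (cong just (sym ie))) , ie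
      keep : ∀ u → P u → P (suc u)
      keep u (ou , iu) = o' , trans i' iu
        where
        ne : ¬ IsEmpty (breakpoint (s u))
        ne emp with trans (sym ou) (emp (p u))
        ... | ()
        i' = proj₁ (RankedStep.on-nonempty (rstep u) ne)
        o' = proj₂ (RankedStep.on-nonempty (rstep u) ne) (p u) (p (suc u)) ou (safe u) (trans (ce (suc u)) (cong just (sym iu)))
      allP : ∀ d → P (d + suc t)
      allP zero = P1
      allP (suc d) = keep _ (allP d)
      contra : ⊥
      contra with accepting-often (suc t)
      ... | u , le , ac with trans (sym (proj₁ (subst P (m∸n+n≡m le) (allP (u ∸ suc t))))) (accepting⇒empty _ ac (p u))
      ... | ()

  no-conflict : Conflict → ⊥
  no-conflict c with antitone-stabilises _ (λ u → orZero (rankOf (Conflict.s c u) (Conflict.p c u))) ≤-refl (ConflictRanks.rank-p-antitone c)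
  ... | T , eq with parity (orZero (rankOf (Conflict.s c T) (Conflict.p c T)))
  ... | inj₁ (o , _) = ConstantRank.evenCase (Conflict-shift c T) _ ce o
    where ce = λ u → trans (ConflictRanks.rank-p c (u + T)) (cong just (eq u))
  ... | inj₂ (o , _) = ConstantRank.oddCase (Conflict-shift c T) _ ce o
    where ce = λ u → trans (ConflictRanks.rank-p c (u + T)) (cong just (eq u))

  module Rejection (w : Word k) (σ : ℕ → State) (σ0 : Initial (σ 0))
    (σs : ∀ t → Step (w t) (σ t) (σ (suc t))) (σacc : Often λ t → Accepting (σ t)) where

    initial⇒tracks : ∀ s q → Initial s → ini q ≡ true → Tracks s q
    initial⇒tracks (subset S) q h i = h q i

    ranked-from : ∀ t₁ → IsRanked (σ t₁) → ∀ d → IsRanked (σ (d + t₁))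
    ranked-from t₁ r zero = r
    ranked-from t₁ r (suc d) = isRanked-step _ _ _ (σs (d + t₁)) (ranked-from t₁ r d)

    sound : accA ≡ genRabinAcc L → Accepts A w → ⊥
    sound eqa (ρ , sat) with Sat-genRabin⁻ L (InfOften A ρ) (subst (λ c → Sat c (InfOften A ρ)) eqa sat)
    ... | c₀-finite , colours-inf with ¬∀⇒∃¬ c₀-finite | σacc 0
    ... | N₀ , no-c₀ | t₁ , _ , accepting₁ = no-conflict conflict
      where
      open Run ρ
      tracks-run : ∀ t → Tracks (σ t) (st t)
      tracks-run zero = initial⇒tracks (σ 0) (st 0) σ0 start
      tracks-run (suc t) = tracks-step _ _ _ _ _ (σs t) (tracks-run t) (step t)
      start₀ = N₀ ⊔ t₁
      ranked-after : ∀ u → IsRanked (σ (u + start₀))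
      ranked-after u = subst (λ z → IsRanked (σ z)) (trans (+-assoc u (start₀ ∸ t₁) t₁) (cong (u +_) (m∸n+n≡m (m≤n⊔m N₀ t₁))))
                 (ranked-from t₁ (accepting⇒ranked _ accepting₁) (u + (start₀ ∸ t₁)))
      no-c₀-after : ∀ i → N₀ ≤ i → col (st i) (w i) (st (suc i)) fz ≡ false
      no-c₀-after i le = ¬-not (λ ct → no-c₀ (i , le , ct))
      conflict : Conflict
      conflict = record
        { s = λ u → σ (u + start₀) ; p = λ u → st (u + start₀) ; a = λ u → w (u + start₀)
        ; allRanked = ranked-after ; steps = λ u → σs (u + start₀)
        ; safe = λ u → step (u + start₀) , no-c₀-after (u + start₀) (≤-trans (m≤m⊔n N₀ t₁) (m≤n+m start₀ u))
        ; tracked = λ u → tracks-run (u + start₀)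
        ; colours-often = λ j → Often-shift {λ u → col (st u) (w u) (st (suc u)) (fs j) ≡ true} start₀ (colours-inf j)
        ; accepting-often = Often-shift {λ u → Accepting (σ u)} start₀ σacc }

module Ranking (em : ExcludedMiddle 0ℓ) {k ℓ' : ℕ} (A : ELA k (suc (suc ℓ'))) (w : Word k) where

  open States em A

  Vertices : Set₁
  Vertices = ℕ → Q → Set

  Reachable : Vertices
  Reachable zero q = ini q ≡ true
  Reachable (suc l) q' = ∃ λ q → Reachable l q × tr q (w l) q' ≡ true

  Arc : ℕ → Q → Q → Set
  Arc l q q' = SafeEdge (w l) q q'

  ArcIn : Vertices → ℕ → Q → Q → Set
  ArcIn H l q q' = H l q × H (suc l) q' × Arc l q q'

  data Path (H : Vertices) (l : ℕ) (q : Q) : ℕ → Q → Set where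
    stay : H l q → Path H l q 0 q
    extend : ∀ {d u v} → Path H l q d u → ArcIn H (d + l) u v → Path H l q (suc d) v

  Endless : Vertices → Vertices
  Endless H l q = ∀ d → ∃ λ v → Path H l q d v

  data ColourPath (H : Vertices) (j : Fin L) : ℕ → Q → Set where
    hit : ∀ {l q q'} → ArcIn H l q q' → col q (w l) q' (fs j) ≡ true → ColourPath H j l q
    pass : ∀ {l q q'} → ArcIn H l q q' → ColourPath H j (suc l) q' → ColourPath H j l q

  Free : Vertices → Vertices
  Free H l q = ∃ λ j → ¬ ColourPath H j l q

  -- Leaving an even stage keeps the vertices with arbitrarily long paths inside it, leaving an
  -- odd stage the non-free ones; the rank of a vertex is the last stage containing it.
  Keep : Bool → Vertices → Vertices
  Keep false H l q = Endless H l q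
  Keep true H l q = ¬ Free H l q

  Stage : ℕ → Vertices
  Stage zero = Reachable
  Stage (suc s) l q = Stage s l q × Keep (isOdd s) (Stage s) l q

  path-source : ∀ {H l q d v} → Path H l q d v → H l q
  path-source (stay x) = x
  path-source (extend p e) = path-source p

  endless⇒member : ∀ {H l q} → Endless H l q → H l q
  endless⇒member i = path-source (proj₂ (i 0))

  path-uncons′ : ∀ {H l q d u v} → Path H l q d u → ArcIn H (d + l) u v → ∃ λ q' → ArcIn H l q q' × Path H (suc l) q' d v
  path-uncons′ (stay x) e = _ , e , stay (proj₁ (proj₂ e))
  path-uncons′ {H} {l} {u = u} {v = v} (extend {d = d} p e') e with path-uncons′ p e'
  ... | q' , h , pp = q' , h , extend pp (subst (λ z → ArcIn H z u v) (sym (+-suc d l)) e)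

  path-uncons : ∀ {H l q d v} → Path H l q (suc d) v → ∃ λ q' → ArcIn H l q q' × Path H (suc l) q' d v
  path-uncons (extend p e) = path-uncons′ p e

  path-cons : ∀ {H l q q' d v} → ArcIn H l q q' → Path H (suc l) q' d v → Path H l q (suc d) v
  path-cons {H} {l} e (stay x) = extend (stay (proj₁ e)) e
  path-cons {H} {l} e (extend {d = d} {u = u} {v = v} p e') = extend (path-cons e p) (subst (λ z → ArcIn H z u v) (+-suc d l) e')

  path-truncate : ∀ {H l q d v} d' → d' ≤ d → Path H l q d v → ∃ λ u → Path H l q d' u
  path-truncate d' le (stay x) with d' | le
  ... | zero | z≤n = _ , stay x
  path-truncate {d = suc d} d' le (extend p e) with m≤n⇒m<n∨m≡n le
  ... | inj₂ refl = _ , extend p e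
  ... | inj₁ (s≤s lt) = path-truncate d' lt p

  endless-successor : ∀ {H l q} → Endless H l q → ∃ λ q' → ArcIn H l q q' × Endless H (suc l) q'
  endless-successor {H} {l} {q} inf with pigeonhole-unbounded (λ q' d → ArcIn H l q q' × ∃ λ v → Path H (suc l) q' d v)
      (λ d → let r = path-uncons (proj₂ (inf (suc d))) in proj₁ r , proj₁ (proj₂ r) , _ , proj₂ (proj₂ r))
      (λ q' d d' le (h , v , p) → h , path-truncate d le p)
  ... | q' , all = q' , proj₁ (all 0) , λ d → proj₂ (all d)

  module Walk (H : Vertices) (l : ℕ) (q : Q) (inf : Endless H l q) where
    wk : (t : ℕ) → Σ Q (λ v → Endless H (t + l) v)
    wk zero = q , inf
    wk (suc t) = proj₁ (endless-successor (proj₂ (wk t))) , proj₂ (proj₂ (endless-successor (proj₂ (wk t))))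

    π : ℕ → Q
    π t = proj₁ (wk t)

    πe : ∀ t → ArcIn H (t + l) (π t) (π (suc t))
    πe t = proj₁ (proj₂ (endless-successor (proj₂ (wk t))))

    πinf : ∀ t → Endless H (t + l) (π t)
    πinf t = proj₂ (wk t)

  Stage-antitone : ∀ {s s'} → s ≤ s' → ∀ {l q} → Stage s' l q → Stage s l q
  Stage-antitone {s} {s'} le x with m≤n⇒m<n∨m≡n le
  ... | inj₂ refl = x
  Stage-antitone {s} {suc s'} le x | inj₁ (s≤s lt) = Stage-antitone lt (proj₁ x)

  Stage⇒Reachable : ∀ s {l q} → Stage s l q → Reachable l q
  Stage⇒Reachable s {l} {q} x = Stage-antitone {0} {s} z≤n {l} {q} x

  Stage-backward : ∀ s {l q q'} → Reachable l q → Arc l q q' → Stage s (suc l) q' → Stage s l q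
  Stage-backward zero r e x = r
  Stage-backward (suc s) {l} {q} {q'} r e (x , kp) with Stage-backward s r e x
  ... | xq = xq , keep (isOdd s) kp
    where
    he : ArcIn (Stage s) l q q'
    he = xq , x , e
    keep : ∀ b → Keep b (Stage s) (suc l) q' → Keep b (Stage s) l q
    keep false inf zero = _ , stay xq
    keep false inf (suc d) = _ , path-cons he (proj₂ (inf d))
    keep true nf (j , nfp) = nf (j , λ fp → nfp (pass he fp))

  RankIs : ℕ → Q → ℕ → Set
  RankIs l q r = Stage r l q × ¬ Stage (suc r) l q

  rank-unique : ∀ {l q r r'} → RankIs l q r → RankIs l q r' → r ≡ r'
  rank-unique {r = r} {r'} (x , nx) (x' , nx') with <-cmp r r'
  ... | tri≈ _ eq _ = eq
  ... | tri< lt _ _ = ⊥-elim (nx (Stage-antitone lt x'))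
  ... | tri> _ _ gt = ⊥-elim (nx' (Stage-antitone gt x))

  rank : ℕ → Q → Maybe ℕ
  rank l q with em {Σ ℕ (RankIs l q)}
  ... | yes (r , _) = just r
  ... | no _ = nothing

  rank-sound : ∀ {l q r} → rank l q ≡ just r → RankIs l q r
  rank-sound {l} {q} e with em {Σ ℕ (RankIs l q)}
  rank-sound {l} {q} refl | yes (r , ri) = ri

  rank-complete : ∀ {l q r} → RankIs l q r → rank l q ≡ just r
  rank-complete {l} {q} {r} ri with em {Σ ℕ (RankIs l q)}
  ... | yes (r' , ri') = cong just (rank-unique ri' ri)
  ... | no nr = ⊥-elim (nr (r , ri))

  rank-exists : ∀ d {l q} → Stage 0 l q → ¬ Stage d l q → Σ ℕ (RankIs l q)
  rank-exists zero x nx = ⊥-elim (nx x)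
  rank-exists (suc d) {l} {q} x nx with em {Stage d l q}
  ... | yes xd = d , xd , nx
  ... | no nxd = rank-exists d x nxd

  rank-antitone : ∀ {l q q' r r'} → rank l q ≡ just r → rank (suc l) q' ≡ just r' → Arc l q q' → r' ≤ r
  rank-antitone {l} {q} {q'} {r} {r'} e e' ed with r' ≤? r
  ... | yes le = le
  ... | no nle = ⊥-elim (proj₂ (rank-sound e)
          (Stage-backward (suc r) (Stage⇒Reachable r (proj₁ (rank-sound e))) ed (Stage-antitone (≰⇒> nle) (proj₁ (rank-sound e')))))

module Splicing (em : ExcludedMiddle 0ℓ) {k ℓ' : ℕ} (A : ELA k (suc (suc ℓ'))) (w : Word k) where

  open States em A
  open Ranking em A w

  record AcceptingPath : Set where
    field
      l0 : ℕ
      π : ℕ → Q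
      source-reachable : Reachable l0 (π 0)
      safe-arcs : ∀ t → Arc (t + l0) (π t) (π (suc t))
      hits-colours : ∀ j → Often λ t → col (π t) (w (t + l0)) (π (suc t)) (fs j) ≡ true

  _◂_ : Q → (ℕ → Q) → ℕ → Q
  (q ◂ π) zero = q
  (q ◂ π) (suc t) = π t

  IsRunFrom : ℕ → (ℕ → Q) → Set
  IsRunFrom l π = ∀ t → tr (π t) (w (t + l)) (π (suc t)) ≡ true

  ◂-isRunFrom : ∀ {l q π} → tr q (w l) (π 0) ≡ true → IsRunFrom (suc l) π → IsRunFrom l (q ◂ π)
  ◂-isRunFrom t run zero = t
  ◂-isRunFrom {l} {q} {π} t run (suc u) = subst (λ z → tr (π u) (w z) (π (suc u)) ≡ true) (+-suc u l) (run u)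

  record RunExtending (l : ℕ) (π : ℕ → Q) : Set where
    field
      run : Run A w
      agrees : ∀ t → Run.st run (t + l) ≡ π t

  extend-backwards : ∀ l {π} → Reachable l (π 0) → IsRunFrom l π → RunExtending l π
  extend-backwards zero {π} r steps = record
    { run = record { st = π ; start = r ; step = λ t → subst (λ z → tr (π t) (w z) (π (suc t)) ≡ true) (+-identityʳ t) (steps t) }
    ; agrees = λ t → cong π (+-identityʳ t) }
  extend-backwards (suc l) {π} (q , r , t) steps = record
    { run = run ; agrees = λ u → trans (cong (Run.st run) (+-suc u l)) (agrees (suc u)) }
    where open RunExtending (extend-backwards l {q ◂ π} r (◂-isRunFrom t steps))

  module FromAcceptingPath (accepting-path : AcceptingPath) (eqa : accA ≡ genRabinAcc L) where
    open AcceptingPath accepting-path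
    open RunExtending (extend-backwards l0 source-reachable (λ t → proj₁ (safe-arcs t)))
    open Run run

    colour-agrees : ∀ t c → col (st (t + l0)) (w (t + l0)) (st (suc (t + l0))) c ≡ col (π t) (w (t + l0)) (π (suc t)) c
    colour-agrees t c = cong₂ (λ a b → col a (w (t + l0)) b c) (agrees t) (agrees (suc t))

    accepted : Accepts A w
    accepted = run , subst (λ c → Sat c (InfOften A run)) (sym eqa) (Sat-genRabin⁺ L (InfOften A run) nf al)
      where
      nf : InfOften A run fz → ⊥
      nf io with io l0
      ... | i , le , ct with trans (sym ct) (subst (λ z → col (st z) (w z) (st (suc z)) fz ≡ false) (m∸n+n≡m le)
                            (trans (colour-agrees (i ∸ l0) fz) (proj₂ (safe-arcs (i ∸ l0)))))
      ... | ()
      al : ∀ j → InfOften A run (fs j)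
      al j N with hits-colours j N
      ... | t , le , ct = t + l0 , ≤-trans le (m≤m+n t l0) , trans (colour-agrees t (fs j)) ct

module FreeVertices (em : ExcludedMiddle 0ℓ) {k ℓ' : ℕ} (A : ELA k (suc (suc ℓ'))) (w : Word k)
  (nacc : Accepts A w → ⊥) (eqa : ELA.acc A ≡ genRabinAcc (suc ℓ')) where

  open States em A
  open Ranking em A w
  open Splicing em A w

  cycleColour : ℕ → Fin L
  cycleColour c = fromℕ< (m%n<n c L)

  cycleColour-+* : ∀ (j : Fin L) c → cycleColour (toℕ j + c * L) ≡ j
  cycleColour-+* j c = FP.toℕ-injective (trans (FP.toℕ-fromℕ< (m%n<n (toℕ j + c * L) L))
    (trans ([m+kn]%n≡m%n (toℕ j) c L) (m<n⇒m%n≡m (FP.toℕ<n j))))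

  -- Without free vertices, every vertex of Stage s reaches each Inf-colour inside Stage s;
  -- chaining such paths for the colours taken cyclically gives an accepting run of A.
  module NoFreeVertex (s : ℕ) (l0 : ℕ) (q0 : Q) (x0 : Stage s l0 q0) (noFree : ∀ l q → Stage s l q → ¬ Free (Stage s) l q) where
    H = Stage s

    colour-paths : ∀ l q → H l q → ∀ j → ColourPath H j l q
    colour-paths l q x j = dne (λ nfp → noFree l q x (j , nfp))

    Cursor : ℕ → Set
    Cursor t = Σ Q λ v → Σ ℕ λ c → ColourPath H (cycleColour c) (t + l0) v

    advance : ∀ {t} → Cursor t → Cursor (suc t)
    advance {t} (v , c , hit {q' = q'} he _) = q' , suc c , colour-paths (suc t + l0) q' (proj₁ (proj₂ he)) (cycleColour (suc c))
    advance (v , c , pass {q' = q'} he fp) = q' , c , fp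

    advance-arc : ∀ {t} (x : Cursor t) → ArcIn H (t + l0) (proj₁ x) (proj₁ (advance x))
    advance-arc (v , c , hit he _) = he
    advance-arc (v , c , pass he fp) = he

    cursor : (t : ℕ) → Cursor t
    cursor zero = q0 , 0 , colour-paths l0 q0 x0 (cycleColour 0)
    cursor (suc t) = advance (cursor t)

    vertex : ℕ → Q
    vertex t = proj₁ (cursor t)
    counter : ℕ → ℕ
    counter t = proj₁ (proj₂ (cursor t))

    Progress : ℕ → Set
    Progress t = ∃ λ t' → t ≤ t' × counter (suc t') ≡ suc (counter t) ×
               col (vertex t') (w (t' + l0)) (vertex (suc t')) (fs (cycleColour (counter t))) ≡ true

    progress-from : ∀ {t v c} (cp : ColourPath H (cycleColour c) (t + l0) v) → cursor t ≡ (v , c , cp) → Progress t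
    progress-from {t} {v} {c} (hit {q' = q'} he hits) eq =
      t , ≤-refl , trans (cong (λ y → proj₁ (proj₂ (advance y))) eq) (cong suc (sym counter≡)) ,
      subst₂ (λ a b → col a (w (t + l0)) b (fs (cycleColour (counter t))) ≡ true)
        (sym (cong proj₁ eq)) (sym (cong (λ y → proj₁ (advance y)) eq))
        (subst (λ c' → col v (w (t + l0)) q' (fs (cycleColour c')) ≡ true) (sym counter≡) hits)
      where
      counter≡ : counter t ≡ c
      counter≡ = cong (λ y → proj₁ (proj₂ y)) eq
    progress-from {t} {v} {c} (pass he fp) eq with progress-from {suc t} fp (cong advance eq)
    ... | t' , le , e1 , e2 = t' , ≤-trans (n≤1+n t) le , trans e1 (cong suc counter≡) ,
        subst (λ c' → col (vertex t') (w (t' + l0)) (vertex (suc t')) (fs (cycleColour c')) ≡ true) counter≡ e2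
      where
      counter≡ : counter (suc t) ≡ counter t
      counter≡ = trans (cong (λ y → proj₁ (proj₂ (advance y))) eq) (sym (cong (λ y → proj₁ (proj₂ y)) eq))

    progress : ∀ t → Progress t
    progress t = progress-from (proj₂ (proj₂ (cursor t))) refl

    counter-reaches : ∀ K t → ∃ λ t' → t ≤ t' × counter t' ≡ K + counter t
    counter-reaches zero t = t , ≤-refl , refl
    counter-reaches (suc K) t with progress t
    ... | t2 , le2 , e2 , _ with counter-reaches K (suc t2)
    ... | t' , le' , e' = t' , ≤-trans le2 (≤-trans (n≤1+n t2) le') , trans e' (trans (cong (K +_) e2) (+-suc K (counter t)))

    hits-every-colour : ∀ j → Often λ t → col (vertex t) (w (t + l0)) (vertex (suc t)) (fs j) ≡ true
    hits-every-colour j N with counter-reaches (toℕ j + counter N * L ∸ counter N) N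
    ... | t' , le' , e' with progress t'
    ... | t'' , le'' , _ , c'' = t'' , ≤-trans le' le'' , subst (λ z → col (vertex t'') (w (t'' + l0)) (vertex (suc t'')) (fs z) ≡ true) cmq c''
      where
      V = toℕ j + counter N * L
      cV : counter t' ≡ V
      cV = trans e' (m∸n+n≡m (≤-trans (m≤m*n (counter N) L) (m≤n+m (counter N * L) (toℕ j))))
      cmq : cycleColour (counter t') ≡ j
      cmq = trans (cong cycleColour cV) (cycleColour-+* j (counter N))

    accepting-path : AcceptingPath
    accepting-path = record
      { l0 = l0 ; π = vertex ; source-reachable = Stage⇒Reachable s x0
      ; safe-arcs = λ t → proj₂ (proj₂ (advance-arc (cursor t))) ; hits-colours = hits-every-colour }

    contra : ⊥
    contra = nacc (FromAcceptingPath.accepted accepting-path eqa)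

  abstract
    free-vertex-exists : ∀ s l0 q0 → Stage s l0 q0 → ∃ λ l → ∃ λ q → Stage s l q × Free (Stage s) l q
    free-vertex-exists s l0 q0 x0 = dne λ nf → NoFreeVertex.contra s l0 q0 x0 (λ l q x fr → nf (l , q , x , fr))

  keep-even⁻ : ∀ {b} {H : Vertices} {l q} → b ≡ false → Keep b H l q → Endless H l q
  keep-even⁻ refl k = k
  keep-even⁺ : ∀ {b} {H : Vertices} {l q} → b ≡ false → Endless H l q → Keep b H l q
  keep-even⁺ refl k = k
  keep-odd⁻ : ∀ {b} {H : Vertices} {l q} → b ≡ true → Keep b H l q → ¬ Free H l q
  keep-odd⁻ refl k = k
  keep-odd⁺ : ∀ {b} {H : Vertices} {l q} → b ≡ true → ¬ Free H l q → Keep b H l q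
  keep-odd⁺ refl k = k

  ConstantRankLine : ℕ → Set
  ConstantRankLine s = Σ ℕ λ l0 → Σ (ℕ → Q) λ π → ∀ t → rank (t + l0) (π t) ≡ just s

  Inhabited : ℕ → Set
  Inhabited s = ∃ λ l → ∃ λ q → Stage s l q

  abstract
    odd-stage-line : ∀ h → Inhabited (suc (2 * h)) → ConstantRankLine (suc (2 * h))
    odd-stage-line h (l1 , q1 , x1) with free-vertex-exists (suc (2 * h)) l1 q1 x1
    ... | l , q , (x , kp) , fr = l , Wk.π , λ t → rank-complete (xs t , λ xs' → keep-odd⁻ od (proj₂ xs') (frs t))
      where
      ev : isOdd (2 * h) ≡ false
      ev = isOdd-2* h
      od : isOdd (suc (2 * h)) ≡ true
      od = cong not ev
      module Wk = Walk (Stage (2 * h)) l q (keep-even⁻ ev kp)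
      xs : ∀ t → Stage (suc (2 * h)) (t + l) (Wk.π t)
      xs t = endless⇒member (Wk.πinf t) , keep-even⁺ ev (Wk.πinf t)
      frs : ∀ t → Free (Stage (suc (2 * h))) (t + l) (Wk.π t)
      frs zero = fr
      frs (suc t) with frs t
      ... | j , nfp = j , λ fp → nfp (pass (xs t , xs (suc t) , proj₂ (proj₂ (Wk.πe t))) fp)

  -- The n + 1 odd stages 1, 3, …, 2n+1 would each carry a line of constant rank, so beyond all
  -- their starting levels one level would hold n + 1 distinct ranks on n states.
  module StageOverflow (l1 : ℕ) (q1 : Q) (x1 : Stage (suc (2 * n)) l1 q1) where
    oddLineAt : (h : Fin (suc n)) → ConstantRankLine (suc (2 * toℕ h))
    oddLineAt h = odd-stage-line (toℕ h) (l1 , q1 , Stage-antitone (s≤s (*-monoʳ-≤ 2 (FP.toℕ≤pred[n] h))) x1)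
    level = maxᶠ (λ h → proj₁ (oddLineAt h))
    vertexOf : Fin (suc n) → Q
    vertexOf h = proj₁ (proj₂ (oddLineAt h)) (level ∸ proj₁ (oddLineAt h))
    rank-vertexOf : ∀ h → rank level (vertexOf h) ≡ just (suc (2 * toℕ h))
    rank-vertexOf h = subst (λ z → rank z (vertexOf h) ≡ just (suc (2 * toℕ h))) (m∸n+n≡m (≤-maxᶠ (λ h → proj₁ (oddLineAt h)) h))
              (proj₂ (proj₂ (oddLineAt h)) (level ∸ proj₁ (oddLineAt h)))
    contra : ⊥
    contra with FP.pigeonhole (n<1+n n) vertexOf
    ... | i , j , i<j , eq = <-irrefl (*-cancelˡ-≡ (toℕ i) (toℕ j) 2 (suc-injective (MP.just-injective same-rank))) i<j
      where
      same-rank : just (suc (2 * toℕ i)) ≡ just (suc (2 * toℕ j))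
      same-rank = trans (sym (rank-vertexOf i)) (trans (cong (rank level) eq) (rank-vertexOf j))

  Stage-2n+1-empty : ¬ Inhabited (suc (2 * n))
  Stage-2n+1-empty (l1 , q1 , x1) = StageOverflow.contra l1 q1 x1

module ComplementRun (em : ExcludedMiddle 0ℓ) {k ℓ' : ℕ} (A : ELA k (suc (suc ℓ'))) (w : Word k)
  (nacc : Accepts A w → ⊥) (eqa : ELA.acc A ≡ genRabinAcc (suc ℓ')) where

  open States em A
  open Ranking em A w
  open Splicing em A w
  open FreeVertices em A w nacc eqa

  LeastEmptyOddStage : Set
  LeastEmptyOddStage = Σ ℕ λ m → m ≤ n × ¬ Inhabited (suc (2 * m)) × (∀ h → h < m → Inhabited (suc (2 * h)))

  search-empty-odd-stage : ∀ d h → d + h ≡ n → (∀ h' → h' < h → Inhabited (suc (2 * h'))) → LeastEmptyOddStage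
  search-empty-odd-stage d h eq prev with em {Inhabited (suc (2 * h))}
  ... | no nne = h , subst (h ≤_) eq (m≤n+m h d) , nne , prev
  search-empty-odd-stage zero h eq prev | yes ne = ⊥-elim (Stage-2n+1-empty (subst (λ z → Inhabited (suc (2 * z))) eq ne))
  search-empty-odd-stage (suc d) h eq prev | yes ne = search-empty-odd-stage d (suc h) (trans (+-suc d h) eq) prev'
    where
    prev' : ∀ h' → h' < suc h → Inhabited (suc (2 * h'))
    prev' h' (s≤s le) with m≤n⇒m<n∨m≡n le
    ... | inj₁ lt = prev h' lt
    ... | inj₂ refl = ne

  leastEmptyOddStage : LeastEmptyOddStage
  leastEmptyOddStage = search-empty-odd-stage n 0 (+-identityʳ n) (λ h' ())

  m : ℕ
  m = proj₁ leastEmptyOddStage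

  m≤n : m ≤ n
  m≤n = proj₁ (proj₂ leastEmptyOddStage)

  Stage-2m+1-empty : ¬ Inhabited (suc (2 * m))
  Stage-2m+1-empty = proj₁ (proj₂ (proj₂ leastEmptyOddStage))

  odd-stage-inhabited : ∀ h → h < m → Inhabited (suc (2 * h))
  odd-stage-inhabited = proj₂ (proj₂ (proj₂ leastEmptyOddStage))

  oddLine : (i : Fin m) → ConstantRankLine (suc (2 * toℕ i))
  oddLine i = odd-stage-line (toℕ i) (odd-stage-inhabited (toℕ i) (FP.toℕ<n i))

  settled : ℕ
  settled = maxᶠ (λ i → proj₁ (oddLine i))

  odd-ranks-present : ∀ l → settled ≤ l → ∀ h → h < m → ∃ λ q → rank l q ≡ just (suc (2 * h))
  odd-ranks-present l le h lt = qv , subst (λ z → rank l qv ≡ just (suc (2 * z))) (FP.toℕ-fromℕ< lt)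
     (subst (λ z → rank z qv ≡ just (suc (2 * toℕ i))) (m∸n+n≡m (≤-trans (≤-maxᶠ (λ i → proj₁ (oddLine i)) i) le))
       (proj₂ (proj₂ (oddLine i)) (l ∸ proj₁ (oddLine i))))
    where
    i = fromℕ< lt
    qv = proj₁ (proj₂ (oddLine i)) (l ∸ proj₁ (oddLine i))

  rank≤2m : ∀ {l q r} → rank l q ≡ just r → r ≤ 2 * m
  rank≤2m {l} {q} {r} e with r ≤? 2 * m
  ... | yes le = le
  ... | no nle = ⊥-elim (Stage-2m+1-empty (l , q , Stage-antitone (≰⇒> nle) (proj₁ (rank-sound e))))

  reachable⇒ranked : ∀ {l q} → Reachable l q → ∃ λ r → rank l q ≡ just r
  reachable⇒ranked {l} {q} r with rank-exists (suc (2 * m)) r (λ x → Stage-2m+1-empty (l , q , x))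
  ... | r' , ri = r' , rank-complete ri

  colourIndexAt : ℕ → Q → Fin L
  colourIndexAt l q = leastTrue (λ j → holds (¬ ColourPath (Stage (orZero (rank l q))) j l q))

  odd-rank⇒free : ∀ {l q r} → rank l q ≡ just r → isOdd r ≡ true → Free (Stage r) l q
  odd-rank⇒free e o = dne λ nf → proj₂ (rank-sound e) (proj₁ (rank-sound e) , keep-odd⁺ o nf)

  even-rank⇒finite : ∀ {l q r} → rank l q ≡ just r → isOdd r ≡ false → ¬ Endless (Stage r) l q
  even-rank⇒finite e o inf = proj₂ (rank-sound e) (proj₁ (rank-sound e) , keep-even⁺ o inf)

  odd-rank-colour : ∀ {l q q' r} → rank l q ≡ just r → rank (suc l) q' ≡ just r → Arc l q q' → isOdd r ≡ true →
       (toℕ (colourIndexAt (suc l) q') ≤ toℕ (colourIndexAt l q)) × col q (w l) q' (fs (colourIndexAt l q)) ≡ false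
  odd-rank-colour {l} {q} {q'} {r} e e' ed o = le , ¬-not (λ c → nfpJ (hit he c))
    where
    he : ArcIn (Stage r) l q q'
    he = proj₁ (rank-sound e) , proj₁ (rank-sound e') , ed
    j0 = proj₁ (odd-rank⇒free e o)
    p = λ j → holds (¬ ColourPath (Stage (orZero (rank l q))) j l q)
    sp = leastTrue-spec p j0 (⇒holds (subst (λ z → ¬ ColourPath (Stage (orZero z)) j0 l q) (sym e) (proj₂ (odd-rank⇒free e o))))
    nfpJ : ¬ ColourPath (Stage r) (colourIndexAt l q) l q
    nfpJ = subst (λ z → ¬ ColourPath (Stage (orZero z)) (colourIndexAt l q) l q) e (holds⇒ (proj₁ sp))
    p' = λ j → holds (¬ ColourPath (Stage (orZero (rank (suc l) q'))) j (suc l) q')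
    sp' = leastTrue-spec p' (colourIndexAt l q) (⇒holds (subst (λ z → ¬ ColourPath (Stage (orZero z)) (colourIndexAt l q) (suc l) q') (sym e')
            (λ fp → nfpJ (pass he fp))))
    le : toℕ (colourIndexAt (suc l) q') ≤ toℕ (colourIndexAt l q)
    le = proj₂ sp'

  phaseStart : ℕ
  phaseStart = suc settled

  Breakpoints : Set
  Breakpoints = ℕ × (Q → Bool)

  breakpoints-step : (u : ℕ) → (x : Breakpoints) → Dec (IsEmpty (proj₂ x)) → Breakpoints
  breakpoints-step u (i , O) (yes _) = nextEven i (rank (suc u + phaseStart)) , λ q' → holds (rank (suc u + phaseStart) q' ≡ just (nextEven i (rank (suc u + phaseStart))))
  breakpoints-step u (i , O) (no _) = i , λ q' → holds (rank (suc u + phaseStart) q' ≡ just i × ∃ λ q → O q ≡ true × Arc (u + phaseStart) q q')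

  bps : ℕ → Breakpoints
  bps zero = 0 , λ q → holds (rank phaseStart q ≡ just 0)
  bps (suc u) = breakpoints-step u (bps u) (em {IsEmpty (proj₂ (bps u))})

  bpRank : ℕ → ℕ
  bpRank u = proj₁ (bps u)
  bpSet : ℕ → Q → Bool
  bpSet u = proj₂ (bps u)

  bp-on-empty : ∀ u → IsEmpty (bpSet u) → (bpRank (suc u) ≡ nextEven (bpRank u) (rank (suc u + phaseStart))) ×
           (∀ q' → rank (suc u + phaseStart) q' ≡ just (bpRank (suc u)) → bpSet (suc u) q' ≡ true)
  bp-on-empty u emp with em {IsEmpty (proj₂ (bps u))}
  ... | yes _ = refl , λ q' e → ⇒holds e
  ... | no ne = ⊥-elim (ne emp)

  bp-on-nonempty : ∀ u → ¬ IsEmpty (bpSet u) → (bpRank (suc u) ≡ bpRank u) ×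
           (∀ q q' → bpSet u q ≡ true → Arc (u + phaseStart) q q' → rank (suc u + phaseStart) q' ≡ just (bpRank u) → bpSet (suc u) q' ≡ true)
  bp-on-nonempty u ne with em {IsEmpty (proj₂ (bps u))}
  ... | yes emp = ⊥-elim (ne emp)
  ... | no _ = refl , λ q q' o ed e → ⇒holds (e , q , o , ed)

  bpSet-predecessor : ∀ u q' → ¬ IsEmpty (bpSet u) → bpSet (suc u) q' ≡ true → ∃ λ q → bpSet u q ≡ true × Arc (u + phaseStart) q q'
  bpSet-predecessor u q' ne o with em {IsEmpty (proj₂ (bps u))}
  ... | yes emp = ⊥-elim (ne emp)
  ... | no _ = proj₂ (holds⇒ o)

  bpSet-rank : ∀ u q → bpSet u q ≡ true → rank (u + phaseStart) q ≡ just (bpRank u)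
  bpSet-rank zero q o = holds⇒ o
  bpSet-rank (suc u) q o with em {IsEmpty (proj₂ (bps u))}
  ... | yes _ = holds⇒ o
  ... | no _ = proj₁ (holds⇒ o)

  maxRank-rank : ∀ l → maxRank (rank l) ≤ 2 * m
  maxRank-rank l = maxRank-≤ (rank l) (2 * m) (λ q r e → rank≤2m e)

  bpRank-even : ∀ u → (∃ λ h → bpRank u ≡ 2 * h) × bpRank u ≤ 2 * m
  bpRank-even zero = (0 , refl) , z≤n
  bpRank-even (suc u) with em {IsEmpty (proj₂ (bps u))} | bpRank-even u
  ... | no _ | ih = ih
  ... | yes _ | (h , eh) , le with nextEven-cases (bpRank u) (rank (suc u + phaseStart))
  ... | inj₂ z = (0 , z) , subst (_≤ 2 * m) (sym z) z≤n
  ... | inj₁ (eq , le2) = (suc h , trans eq (trans (cong (_+ 2) eh) (trans (+-comm (2 * h) 2) (sym (*-distribˡ-+ 2 1 h))))) ,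
                          subst (_≤ 2 * m) (sym eq) (≤-trans le2 (maxRank-rank _))

  -- If the breakpoint set never empties from N on, each member traces back to a member at level
  -- N along a path of constant even rank; these paths are arbitrarily long, but vertices of even
  -- rank have finite futures.
  module StuckBreakpoint (N : ℕ) (stuck : ∀ u → N ≤ u → ¬ IsEmpty (bpSet u)) where
    e = bpRank N

    rank-constant : ∀ d → bpRank (d + N) ≡ e
    rank-constant zero = refl
    rank-constant (suc d) = trans (proj₁ (bp-on-nonempty (d + N) (stuck (d + N) (m≤n+m N d)))) (rank-constant d)

    rank-of-member : ∀ d q → bpSet (d + N) q ≡ true → RankIs (d + N + phaseStart) q e
    rank-of-member d q o = rank-sound (trans (bpSet-rank (d + N) q o) (cong just (rank-constant d)))

    trace : ∀ d v → bpSet (d + N) v ≡ true → ∃ λ q → bpSet N q ≡ true × Path (Stage e) (N + phaseStart) q d v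
    trace zero v o = v , o , stay (proj₁ (rank-of-member 0 v o))
    trace (suc d) v o with bpSet-predecessor (d + N) v (stuck (d + N) (m≤n+m N d)) o
    ... | q' , oq' , ed with trace d q' oq'
    ... | q , oq , pth = q , oq , extend pth (subst (λ z → ArcIn (Stage e) z q' v) (+-assoc d N phaseStart)
            (proj₁ (rank-of-member d q' oq') , proj₁ (rank-of-member (suc d) v o) , ed))

    ev : isOdd e ≡ false
    ev with proj₁ (bpRank-even N)
    ... | h , eh = trans (cong isOdd eh) (isOdd-2* h)

    depth : Q → ℕ
    depth q with em {bpSet N q ≡ true}
    ... | yes o = proj₁ (¬∀⇒∃¬ (even-rank⇒finite {r = e} (rank-complete {r = e} (rank-of-member 0 q o)) ev))
    ... | no _ = 0

    depth-spec : ∀ q → bpSet N q ≡ true → ¬ ∃ λ v → Path (Stage e) (N + phaseStart) q (depth q) v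
    depth-spec q o with em {bpSet N q ≡ true}
    ... | yes o' = proj₂ (¬∀⇒∃¬ (even-rank⇒finite {r = e} (rank-complete {r = e} (rank-of-member 0 q o')) ev))
    ... | no no' = ⊥-elim (no' o)

    contra : ⊥
    contra with ¬∀⇒∃¬ (stuck (maxᶠ depth + N) (m≤n+m N _))
    ... | v , nv with trace (maxᶠ depth) v (¬-not nv)
    ... | q , oq , pth = depth-spec q oq (path-truncate (depth q) (≤-maxᶠ depth q) pth)

  breakpoints-empty-often : Often λ u → IsEmpty (bpSet u)
  breakpoints-empty-often N = dne λ ne → StuckBreakpoint.contra N (λ u le emp → ne (u , le , emp))

  -- B stays in the subset phase until every odd rank below 2m has appeared (level `settled`),
  -- then follows the true ranking with the breakpoint construction.
  σ : ℕ → State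
  σ l with l ≤? settled
  ... | yes _ = subset (λ q → holds (Reachable l q))
  ... | no _ = ranked (rank l) (bpSet (l ∸ phaseStart)) (bpRank (l ∸ phaseStart)) (colourIndexAt l)

  σ-before : ∀ l → l ≤ settled → σ l ≡ subset (λ q → holds (Reachable l q))
  σ-before l le with l ≤? settled
  ... | yes _ = refl
  ... | no nle = ⊥-elim (nle le)

  σ-ranked : ℕ → State
  σ-ranked u = ranked (rank (u + phaseStart)) (bpSet u) (bpRank u) (colourIndexAt (u + phaseStart))

  σ-after : ∀ u → σ (u + phaseStart) ≡ σ-ranked u
  σ-after u with u + phaseStart ≤? settled
  ... | yes le = ⊥-elim (<-irrefl refl (≤-trans (m≤n+m phaseStart u) le))
  ... | no _ = cong (λ z → ranked (rank (u + phaseStart)) (bpSet z) (bpRank z) (colourIndexAt (u + phaseStart))) (m+n∸n≡m u phaseStart)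

  2m≤rankCap : 2 * m ≤ rankCap
  2m≤rankCap = ≤-trans (*-monoʳ-≤ 2 m≤n) (m≤m+n (2 * n) 2)

  step-ranked : ∀ u → Step (w (u + phaseStart)) (σ-ranked u) (σ-ranked (suc u))
  step-ranked u = record
    { covers = λ q q' r e t → reachable⇒ranked (_ , Stage⇒Reachable r (proj₁ (rank-sound e)) , t)
    ; antitone = λ q q' r r' e e' ed → rank-antitone e e' ed
    ; odd-colour = λ q q' r e e' ed o → odd-rank-colour e e' ed o
    ; on-empty = bp-on-empty u
    ; on-nonempty = bp-on-nonempty u
    ; bounded = λ q r e → ≤-trans (rank≤2m e) 2m≤rankCap }

  step-settle : Step (w settled) (subset (λ q → holds (Reachable settled q))) (σ-ranked 0)
  step-settle = (λ q q' r t → reachable⇒ranked (q , holds⇒ r , t)) , λ q r e → ≤-trans (rank≤2m e) 2m≤rankCap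

  σstep : ∀ l → Step (w l) (σ l) (σ (suc l))
  σstep l = by-phase (suc l ≤? settled) (l ≤? settled)
    where
    by-phase : Dec (suc l ≤ settled) → Dec (l ≤ settled) → Step (w l) (σ l) (σ (suc l))
    by-phase (yes sle) _ = subst₂ (Step (w l)) (sym (σ-before l (≤-trans (n≤1+n l) sle))) (sym (σ-before (suc l) sle))
                    (λ q q' r t → ⇒holds (q , holds⇒ r , t))
    by-phase (no nsle) (yes le) = subst (λ z → Step (w z) (σ z) (σ (suc z))) (sym eq)
                     (subst₂ (Step (w settled)) (sym (σ-before settled ≤-refl)) (sym (σ-after 0)) step-settle)
      where
      eq : l ≡ settled
      eq = ≤-antisym le (≤-pred (≰⇒> nsle))
    by-phase (no nsle) (no nle) = subst (λ z → Step (w z) (σ z) (σ (suc z))) (m∸n+n≡m (≰⇒> nle))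
                     (subst₂ (Step (w (l ∸ phaseStart + phaseStart))) (sym (σ-after (l ∸ phaseStart)))
                       (sym (σ-after (suc (l ∸ phaseStart)))) (step-ranked (l ∸ phaseStart)))

  σinit : Initial (σ 0)
  σinit = subst Initial (sym (σ-before 0 z≤n)) (λ q i → ⇒holds i)

  σacc : Often λ t → Accepting (σ t)
  σacc N with breakpoints-empty-often N
  ... | u , le , emp = u + phaseStart , ≤-trans le (m≤m+n u phaseStart) , subst Accepting (sym (σ-after u)) emp

  σgood : ∀ t → WellFormed (σ t)
  σgood t with t ≤? settled
  ... | yes _ = tt
  ... | no nle = m , proj₁ (bpRank-even u) , proj₂ (bpRank-even u) , (λ q r e → rank≤2m e) ,
                   (λ h lt → odd-ranks-present t (≤-trans (n≤1+n settled) (≰⇒> nle)) h lt) ,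
                   (λ q o → subst (λ z → rank z q ≡ just (bpRank u)) (m∸n+n≡m (≰⇒> nle)) (bpSet-rank u q o))
    where u = t ∸ phaseStart

module Decoding (em : ExcludedMiddle 0ℓ) {k ℓ' : ℕ} (A : ELA k (suc (suc ℓ'))) where

  open States em A

  _≈_ : State → State → Set
  subset S ≈ subset S' = ∀ q → S q ≡ S' q
  subset _ ≈ ranked _ _ _ _ = ⊥
  ranked _ _ _ _ ≈ subset _ = ⊥
  ranked f O i J ≈ ranked f' O' i' J' = (∀ q → f q ≡ f' q) × (∀ q → O q ≡ O' q) × i ≡ i' × (∀ q → J q ≡ J' q)

  ≈-sym : ∀ s1 s2 → s1 ≈ s2 → s2 ≈ s1
  ≈-sym (subset _) (subset _) e q = sym (e q)
  ≈-sym (ranked _ _ _ _) (ranked _ _ _ _) (a , b , c , d) = (λ q → sym (a q)) , (λ q → sym (b q)) , sym c , (λ q → sym (d q))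

  ≈-trans : ∀ s1 s2 s3 → s1 ≈ s2 → s2 ≈ s3 → s1 ≈ s3
  ≈-trans (subset _) (subset _) (subset _) e1 e2 q = trans (e1 q) (e2 q)
  ≈-trans (ranked _ _ _ _) (ranked _ _ _ _) (ranked _ _ _ _) (a1 , b1 , c1 , d1) (a2 , b2 , c2 , d2) =
    (λ q → trans (a1 q) (a2 q)) , (λ q → trans (b1 q) (b2 q)) , trans c1 c2 , (λ q → trans (d1 q) (d2 q))

  maxRank-resp : ∀ {a} (f f' : Fin a → Maybe ℕ) → (∀ q → f q ≡ f' q) → maxRank f ≡ maxRank f'
  maxRank-resp f f' h = maxᶠ-cong (λ q → cong orZero (h q))

  nextEven-resp : ∀ i f f' → (∀ q → f q ≡ f' q) → nextEven i f ≡ nextEven i f'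
  nextEven-resp i f f' h with nextEven-cases i f | nextEven-cases i f'
  ... | inj₁ (e , le) | _ = trans e (sym (nextEven-≡ i f' (subst (i + 2 ≤_) (maxRank-resp f f' h) le)))
  ... | inj₂ z | inj₂ z' = trans z (sym z')
  ... | inj₂ z | inj₁ (e' , le') = ⊥-elim (0≢1+n (trans (sym z) (trans (nextEven-≡ i f (subst (i + 2 ≤_) (sym (maxRank-resp f f' h)) le')) (+-comm i 2))))

  Step-resp : ∀ a s1 s1' s2 s2' → s1 ≈ s1' → s2 ≈ s2' → Step a s1 s2 → Step a s1' s2'
  Step-resp a (subset S) (subset S') (subset T) (subset T') e1 e2 st q q' x t = trans (sym (e2 q')) (st q q' (trans (e1 q) x) t)
  Step-resp a (subset S) (subset S') (ranked f O i J) (ranked f' O' i' J') e1 (ef , _) (tracked , bd) =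
    (λ q q' x t → let r = tracked q q' (trans (e1 q) x) t in proj₁ r , trans (sym (ef q')) (proj₂ r)) ,
    (λ q r e → bd q r (trans (ef q) e))
  Step-resp a (ranked f1 O1 i1 J1) (ranked f1' O1' i1' J1') (ranked f2 O2 i2 J2) (ranked f2' O2' i2' J2')
    (ef1 , eO1 , ei1 , eJ1) (ef2 , eO2 , ei2 , eJ2) st = record
    { covers = λ q q' r e t → let x = RankedStep.covers st q q' r (trans (ef1 q) e) t in proj₁ x , trans (sym (ef2 q')) (proj₂ x)
    ; antitone = λ q q' r r' e e' ed → RankedStep.antitone st q q' r r' (trans (ef1 q) e) (trans (ef2 q') e') ed
    ; odd-colour = λ q q' r e e' ed o → let x = RankedStep.odd-colour st q q' r (trans (ef1 q) e) (trans (ef2 q') e') ed o in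
        subst₂ (λ u v → toℕ u ≤ toℕ v) (eJ2 q') (eJ1 q) (proj₁ x) ,
        subst (λ u → col q a q' (fs u) ≡ false) (eJ1 q) (proj₂ x)
    ; on-empty = λ emp' → let x = RankedStep.on-empty st (λ q → trans (eO1 q) (emp' q)) in
        trans (sym ei2) (trans (proj₁ x) (trans (cong (λ z → nextEven z f2) ei1) (nextEven-resp i1' f2 f2' ef2))) ,
        λ q' e → trans (sym (eO2 q')) (proj₂ x q' (trans (ef2 q') (trans e (cong just (sym ei2)))))
    ; on-nonempty = λ nemp → let x = RankedStep.on-nonempty st (λ emp → nemp (λ q → trans (sym (eO1 q)) (emp q))) in
        trans (sym ei2) (trans (proj₁ x) ei1) ,
        λ q q' o ed e → trans (sym (eO2 q')) (proj₂ x q q' (trans (eO1 q) o) ed (trans (ef2 q') (trans e (cong just (sym ei1)))))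
    ; bounded = λ q r e → RankedStep.bounded st q r (trans (ef2 q) e) }

  Initial-resp : ∀ s s' → s ≈ s' → Initial s → Initial s'
  Initial-resp (subset S) (subset S') e h q i = trans (sym (e q)) (h q i)

  Accepting-resp : ∀ s s' → s ≈ s' → Accepting s → Accepting s'
  Accepting-resp (ranked f O i J) (ranked f' O' i' J') (_ , eO , _) emp q = trans (sym (eO q)) (emp q)

  -- A ranked state is stored as the vector (i + b + 1) ∷ entries with shift b ∈ {0, 2}: rank
  -- r < i (or r = i in O) as r + b, larger ranks as r + b + 2, except the top rank 2m outside O,
  -- stored as 2m + b + 3 when flag t is set so that the maximum is odd, and states off the level
  -- as 1 when b = 2.
  decodeRank : ℕ → Bool → ℕ → ℕ → ℕ → Maybe ℕ
  decodeRank b t s M x with x <? b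
  ... | yes _ = nothing
  ... | no _ with x <? s
  ...   | yes _ = just (x ∸ b)
  ...   | no _ with t ∧ (x ≡ᵇ M)
  ...     | true = just (x ∸ (b + 3))
  ...     | false = just (x ∸ (b + 2))

  decodeRanked : ℕ → Bool → Vec ℕ (suc n) → (Q → Fin L) → State
  decodeRanked b t (s ∷ rankVec) J = ranked (λ q → decodeRank b t s (maxV rankVec) (lookup rankVec q)) (λ q → suc (lookup rankVec q) ≡ᵇ s) (s ∸ suc b) J

  decodeVec : Fin 5 → Vec ℕ (suc n) → (Q → Fin L) → State
  decodeVec fz (s ∷ rankVec) J = subset (λ q → lookup rankVec q ≡ᵇ 1)
  decodeVec (fs fz) g J = decodeRanked 0 false g J
  decodeVec (fs (fs fz)) g J = decodeRanked 0 true g J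
  decodeVec (fs (fs (fs fz))) g J = decodeRanked 2 false g J
  decodeVec (fs (fs (fs (fs fz)))) g J = decodeRanked 2 true g J

  #tight : ℕ
  #tight = tight (suc n)

  #states : ℕ
  #states = 5 * (L ^ n * #tight)

  encodeIndex : Fin 5 → (jc : Fin (L ^ n)) → Fin #tight → Fin #states
  encodeIndex tag jc ti = combine tag (combine jc ti)

  abstract
    decQ : Fin 5 → Fin (L ^ n) × Fin #tight → State
    decQ tag (jc , ti) = decodeVec tag (List.lookup (tightVecs (suc n)) ti) (finToFun jc)

    decP : Fin 5 × Fin (L ^ n * #tight) → State
    decP (tag , c) = decQ tag (remQuot #tight c)

    decode : Fin #states → State
    decode x = decP (remQuot (L ^ n * #tight) x)

    decode-encodeIndex : ∀ tag jc ti → decode (encodeIndex tag jc ti) ≡ decodeVec tag (List.lookup (tightVecs (suc n)) ti) (finToFun jc)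
    decode-encodeIndex tag jc ti = trans (cong decP (FP.remQuot-combine {5} {L ^ n * #tight} tag (combine jc ti))) (cong (decQ tag) (FP.remQuot-combine {L ^ n} {#tight} jc ti))

  decodeVec-cong : ∀ tag (g' : Vec ℕ (suc n)) J J' → (∀ q → J q ≡ J' q) → decodeVec tag g' J ≈ decodeVec tag g' J'
  decodeVec-cong fz (s ∷ rankVec) J J' e = λ q → refl
  decodeVec-cong (fs fz) (s ∷ rankVec) J J' e = (λ q → refl) , (λ q → refl) , refl , e
  decodeVec-cong (fs (fs fz)) (s ∷ rankVec) J J' e = (λ q → refl) , (λ q → refl) , refl , e
  decodeVec-cong (fs (fs (fs fz))) (s ∷ rankVec) J J' e = (λ q → refl) , (λ q → refl) , refl , e
  decodeVec-cong (fs (fs (fs (fs fz)))) (s ∷ rankVec) J J' e = (λ q → refl) , (λ q → refl) , refl , e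

  decode-tight : ∀ tag J (g : Vec ℕ (suc n)) → (∀ p → lookup g p < 2 * suc n) → isTight g ≡ true →
    ∃ λ x → decode x ≈ decodeVec tag g J
  decode-tight tag J g b t with tightVecs-index (suc n) g b t
  ... | ti , eti = encodeIndex tag (funToFin J) ti ,
    subst (λ z → z ≈ decodeVec tag g J) (sym (trans (decode-encodeIndex tag (funToFin J) ti) (cong (λ z → decodeVec tag z (finToFun (funToFin J))) eti)))
      (decodeVec-cong tag g _ J (FP.finToFun-funToFin J))

module Encoding (em : ExcludedMiddle 0ℓ) {k ℓ' : ℕ} (A : ELA k (suc (suc ℓ'))) where

  open States em A
  open Decoding em A

  ≢⇒≡ᵇ-false : ∀ {a b} → ¬ a ≡ b → (a ≡ᵇ b) ≡ false
  ≢⇒≡ᵇ-false {zero} {zero} ne = ⊥-elim (ne refl)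
  ≢⇒≡ᵇ-false {zero} {suc b} ne = refl
  ≢⇒≡ᵇ-false {suc a} {zero} ne = refl
  ≢⇒≡ᵇ-false {suc a} {suc b} ne = ≢⇒≡ᵇ-false {a} {b} (λ e → ne (cong suc e))

  decodeRank-absent : ∀ {b t s M x} → x < b → decodeRank b t s M x ≡ nothing
  decodeRank-absent {b} {t} {s} {M} {x} lt with x <? b
  ... | yes _ = refl
  ... | no nlt = ⊥-elim (nlt lt)

  decodeRank-low : ∀ {b t s M x} → ¬ x < b → x < s → decodeRank b t s M x ≡ just (x ∸ b)
  decodeRank-low {b} {t} {s} {M} {x} nb ls with x <? b
  ... | yes lt = ⊥-elim (nb lt)
  ... | no _ with x <? s
  ... | yes _ = refl
  ... | no nls = ⊥-elim (nls ls)

  decodeRank-top : ∀ {b t s M x} → ¬ x < b → ¬ x < s → t ≡ true → x ≡ M → decodeRank b t s M x ≡ just (x ∸ (b + 3))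
  decodeRank-top {b} {t} {s} {M} {x} nb ns et ex with x <? b
  ... | yes lt = ⊥-elim (nb lt)
  ... | no _ with x <? s
  ... | yes ls = ⊥-elim (ns ls)
  ... | no _ rewrite et | ex | ≡ᵇ-refl M = refl

  decodeRank-high : ∀ {b t s M x} → ¬ x < b → ¬ x < s → (t ∧ (x ≡ᵇ M)) ≡ false → decodeRank b t s M x ≡ just (x ∸ (b + 2))
  decodeRank-high {b} {t} {s} {M} {x} nb ns ef with x <? b
  ... | yes lt = ⊥-elim (nb lt)
  ... | no _ with x <? s
  ... | yes ls = ⊥-elim (ns ls)
  ... | no _ rewrite ef = refl

  record RankedData : Set where
    field
      f : Q → Maybe ℕ
      O : Q → Bool
      i : ℕ
      J : Q → Fin L
      m : ℕ
      hi : ℕ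
      ei : i ≡ 2 * hi
      i≤ : i ≤ 2 * m
      rb : ∀ q r → f q ≡ just r → r ≤ 2 * m
      op : ∀ h → h < m → ∃ λ q → f q ≡ just (suc (2 * h))
      oi : ∀ q → O q ≡ true → f q ≡ just i

  shift : Bool → ℕ
  shift true = 2
  shift false = 0

  module RankEncoding (d : RankedData) where
    open RankedData d

    topBonus : ℕ → ℕ
    topBonus r with r ≟ 2 * m
    ... | yes _ = 1
    ... | no _ = 0

    topBonus-yes : ∀ {r} → r ≡ 2 * m → topBonus r ≡ 1
    topBonus-yes {r} e with r ≟ 2 * m
    ... | yes _ = refl
    ... | no ne = ⊥-elim (ne e)

    topBonus-no : ∀ {r} → ¬ r ≡ 2 * m → topBonus r ≡ 0
    topBonus-no {r} e with r ≟ 2 * m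
    ... | yes eq = ⊥-elim (e eq)
    ... | no _ = refl

    Low : ℕ → Bool → Set
    Low r o = r < i ⊎ (r ≡ i × o ≡ true)

    encodeRank : ℕ → ℕ → Bool → ℕ
    encodeRank b r o with em {Low r o}
    ... | yes _ = r + b
    ... | no _ = r + b + 2 + topBonus r

    encodeRank-low : ∀ b {r o} → Low r o → encodeRank b r o ≡ r + b
    encodeRank-low b {r} {o} lw with em {Low r o}
    ... | yes _ = refl
    ... | no nl = ⊥-elim (nl lw)

    encodeRank-high : ∀ b {r o} → ¬ Low r o → encodeRank b r o ≡ r + b + 2 + topBonus r
    encodeRank-high b {r} {o} nl with em {Low r o}
    ... | yes lw = ⊥-elim (nl lw)
    ... | no _ = refl

    encodeRank-top : ∀ b {r o} → ¬ Low r o → r ≡ 2 * m → encodeRank b r o ≡ r + b + 2 + 1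
    encodeRank-top b nl eq = trans (encodeRank-high b nl) (cong (_ + b + 2 +_) (topBonus-yes eq))

    encodeRank-mid : ∀ b {r o} → ¬ Low r o → r ≢ 2 * m → encodeRank b r o ≡ r + b + 2 + 0
    encodeRank-mid b nl ne = trans (encodeRank-high b nl) (cong (_ + b + 2 +_) (topBonus-no ne))

    data RankClass (r : ℕ) (o : Bool) : Set where
      low : Low r o → RankClass r o
      top : ¬ Low r o → r ≡ 2 * m → RankClass r o
      mid : ¬ Low r o → r ≢ 2 * m → RankClass r o

    classify : ∀ r o → RankClass r o
    classify r o with em {Low r o} | r ≟ 2 * m
    ... | yes lw | _ = low lw
    ... | no nl | yes eq = top nl eq
    ... | no nl | no ne = mid nl ne

    encodeEntry : ℕ → Maybe ℕ → Bool → ℕ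
    encodeEntry b nothing o = 1
    encodeEntry b (just r) o = encodeRank b r o

    rankVec : ℕ → Vec ℕ n
    rankVec b = tabulate (λ q → encodeEntry b (f q) (O q))

    headEntry : ℕ → ℕ
    headEntry b = suc (i + b)

    lookup-rankVec : ∀ b q → lookup (rankVec b) q ≡ encodeEntry b (f q) (O q)
    lookup-rankVec b q = lookup∘tabulate (λ q → encodeEntry b (f q) (O q)) q

    high⇒∉breakpoint : ∀ {q r} → f q ≡ just r → ¬ Low r (O q) → O q ≡ false
    high⇒∉breakpoint {q} e nl with O q in eo
    ... | false = refl
    ... | true = ⊥-elim (nl (inj₂ (MP.just-injective (trans (sym e) (oi q eo)) , refl)))

    high⇒i≤ : ∀ {r o} → ¬ Low r o → i ≤ r
    high⇒i≤ {r} nl = ≮⇒≥ (λ lt → nl (inj₁ lt))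

    topEntry : ℕ → ℕ
    topEntry b = 2 * m + b + 3

  bit : Bool → ℕ
  bit true = 1
  bit false = 0

  shift-≡ : ∀ x → shift x ≡ 2 * bit x
  shift-≡ true = refl
  shift-≡ false = refl

  bit≤1 : ∀ x → bit x ≤ 1
  bit≤1 true = s≤s z≤n
  bit≤1 false = z≤n

  bit-true : ∀ x → 1 ≤ bit x → x ≡ true
  bit-true true _ = refl
  bit-true false ()

  ∧-false : ∀ t y → (t ≡ true → y ≡ false) → (t ∧ y) ≡ false
  ∧-false true y h = h refl
  ∧-false false y h = refl

  1+2[a+b]≡1+2a+2b : ∀ a b → suc (2 * (a + b)) ≡ suc (2 * a) + 2 * b
  1+2[a+b]≡1+2a+2b = solve-∀

  1+2a+b+2+0≡1+2[1+a]+b : ∀ a b → suc (2 * a) + b + 2 + 0 ≡ suc (2 * suc a) + b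
  1+2a+b+2+0≡1+2[1+a]+b = solve-∀

  2a+b+2+1≡1+2[1+a]+b : ∀ a b → 2 * a + b + 2 + 1 ≡ suc (2 * suc a) + b
  2a+b+2+1≡1+2[1+a]+b = solve-∀

  a+b+2+1≡a+[b+3] : ∀ a b → a + b + 2 + 1 ≡ a + (b + 3)
  a+b+2+1≡a+[b+3] = solve-∀

  a+b+2+0≡a+[b+2] : ∀ a b → a + b + 2 + 0 ≡ a + (b + 2)
  a+b+2+0≡a+[b+2] = solve-∀

  2a+b+3≡1+2a+[b+2] : ∀ a b → 2 * a + b + 3 ≡ suc (2 * a) + (b + 2)
  2a+b+3≡1+2a+[b+2] = solve-∀

  a+b+2+0≡1+a+b+1 : ∀ a b → a + b + 2 + 0 ≡ suc a + b + 1
  a+b+2+0≡1+a+b+1 = solve-∀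

  a+2+1≡a+1+2*1 : ∀ a → a + 2 + 1 ≡ a + 1 + 2 * 1
  a+2+1≡a+1+2*1 = solve-∀

  2a+2b+1+2c≡1+2[a+b+c] : ∀ a b c → 2 * a + 2 * b + 1 + 2 * c ≡ suc (2 * (a + b + c))
  2a+2b+1+2c≡1+2[a+b+c] = solve-∀

  tag : Bool → Bool → Fin 5
  tag false false = fs fz
  tag false true = fs (fs fz)
  tag true false = fs (fs (fs fz))
  tag true true = fs (fs (fs (fs fz)))

  decodeVec-tag : ∀ bh tt g J → decodeVec (tag bh tt) g J ≡ decodeRanked (shift bh) tt g J
  decodeVec-tag false false g J = refl
  decodeVec-tag false true g J = refl
  decodeVec-tag true false g J = refl
  decodeVec-tag true true g J = refl

  module TightEncoding (d : RankedData) (hasAbsent hasTop : Bool)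
    (absent⇒hasAbsent : ∀ q → RankedData.f d q ≡ nothing → hasAbsent ≡ true)
    (hasAbsent⇒absent : hasAbsent ≡ true → ∃ λ q → RankedData.f d q ≡ nothing)
    (top⇒hasTop : ∀ q → RankedData.f d q ≡ just (2 * RankedData.m d) → RankedData.O d q ≡ false → hasTop ≡ true)
    (hasTop⇒top : hasTop ≡ true → ∃ λ q → RankedData.f d q ≡ just (2 * RankedData.m d) × RankedData.O d q ≡ false) where
    open RankedData d
    open RankEncoding d

    b = shift hasAbsent
    bb = bit hasAbsent
    tb = bit hasTop
    H = m + bb + tb
    maxEntry = suc (2 * H)
    g : Vec ℕ (suc n)
    g = headEntry b ∷ rankVec b
    M = maxV (rankVec b)

    eb : b ≡ 2 * bb
    eb = shift-≡ hasAbsent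

    absent⇒1<b : ∀ {q} → f q ≡ nothing → 1 < b
    absent⇒1<b {q} e = subst (λ z → 1 < shift z) (sym (absent⇒hasAbsent q e)) (s≤s (s≤s z≤n))

    entry≤topEntry : ∀ q → encodeEntry b (f q) (O q) ≤ topEntry b
    entry≤topEntry q with f q in e
    ... | nothing = ≤-trans (s≤s z≤n) (m≤n+m 3 (2 * m + b))
    ... | just r with classify r (O q)
    ...   | low lw = ≤-trans (≤-reflexive (encodeRank-low b lw)) (≤-trans (+-monoˡ-≤ b (rb q r e)) (m≤m+n (2 * m + b) 3))
    ...   | top nl eq = ≤-reflexive (trans (encodeRank-top b nl eq) (trans (+-assoc (r + b) 2 1) (cong (λ z → z + b + 3) eq)))
    ...   | mid nl ne = ≤-trans (≤-reflexive (trans (encodeRank-mid b nl ne) (+-identityʳ _)))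
                          (+-mono-≤ (+-monoˡ-≤ b (rb q r e)) (s≤s (s≤s z≤n)))

    maxV≡topEntry : hasTop ≡ true → M ≡ topEntry b
    maxV≡topEntry et with hasTop⇒top et
    ... | q , e , o = ≤-antisym (maxV-≤ (rankVec b) (topEntry b) (λ q → subst (_≤ topEntry b) (sym (lookup-rankVec b q)) (entry≤topEntry q)))
           (subst (_≤ M) topv (≤-maxV (rankVec b) q))
      where
      nl : ¬ Low (2 * m) (O q)
      nl (inj₁ lt) = <-irrefl refl (<-≤-trans lt i≤)
      nl (inj₂ (_ , ot)) with trans (sym o) ot
      ... | ()
      topv : lookup (rankVec b) q ≡ topEntry b
      topv = trans (lookup-rankVec b q) (trans (cong (λ z → encodeEntry b z (O q)) e)
               (trans (encodeRank-top b nl refl) (+-assoc (2 * m + b) 2 1)))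

    bool-cases : ∀ {P : Set} x → (x ≡ true → P) → (x ≡ false → P) → P
    bool-cases true t f = t refl
    bool-cases false t f = f refl

    head<high : ∀ r → i ≤ r → ∀ δ' → suc (i + b) < r + b + 2 + δ'
    head<high r le δ' = ≤-trans (s≤s (s≤s (+-monoˡ-≤ b le))) (≤-trans (≤-reflexive (sym (+-comm (r + b) 2))) (m≤m+n (r + b + 2) δ'))

    high≮shift : ∀ r → i ≤ r → ∀ δ' → ¬ (r + b + 2 + δ' < b)
    high≮shift r le δ' lt = <-irrefl refl (<-trans lt (≤-trans (s≤s (m≤n+m b i)) (<⇒≤ (head<high r le δ'))))

    high≮head : ∀ r → i ≤ r → ∀ δ' → ¬ (r + b + 2 + δ' < headEntry b)
    high≮head r le δ' lt = <-irrefl refl (<-trans lt (head<high r le δ'))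

    low⇒≤i : ∀ {r o} → Low r o → r ≤ i
    low⇒≤i (inj₁ lt) = <⇒≤ lt
    low⇒≤i (inj₂ (eq , _)) = ≤-reflexive eq

    decode-rank : ∀ q → decodeRank b hasTop (headEntry b) M (encodeEntry b (f q) (O q)) ≡ f q
    decode-rank q with f q in e
    ... | nothing = decodeRank-absent (absent⇒1<b e)
    ... | just r with classify r (O q)
    ...   | low lw = subst (λ x → decodeRank b hasTop (headEntry b) M x ≡ just r) (sym (encodeRank-low b lw))
        (trans (decodeRank-low (λ lt → <-irrefl refl (<-≤-trans lt (m≤n+m b r))) (s≤s (+-monoˡ-≤ b (low⇒≤i lw))))
          (cong just (m+n∸n≡m r b)))
    ...   | top nl eq = subst (λ x → decodeRank b hasTop (headEntry b) M x ≡ just r) (sym (encodeRank-top b nl eq))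
        (trans (decodeRank-top (high≮shift r ir 1) (high≮head r ir 1) et xM)
          (cong just (trans (cong (_∸ (b + 3)) (a+b+2+1≡a+[b+3] r b)) (m+n∸n≡m r (b + 3)))))
      where
      ir = high⇒i≤ nl
      et : hasTop ≡ true
      et = top⇒hasTop q (trans e (cong just eq)) (high⇒∉breakpoint e nl)
      xM : r + b + 2 + 1 ≡ M
      xM = trans (a+b+2+1≡a+[b+3] r b) (trans (cong (_+ (b + 3)) eq) (trans (sym (+-assoc (2 * m) b 3)) (sym (maxV≡topEntry et))))
    ...   | mid nl ne = subst (λ x → decodeRank b hasTop (headEntry b) M x ≡ just r) (sym (encodeRank-mid b nl ne))
        (trans (decodeRank-high (high≮shift r ir 0) (high≮head r ir 0) (∧-false hasTop _ (λ et → ≢⇒≡ᵇ-false (λ xM → not-max et xM))))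
          (cong just (trans (cong (_∸ (b + 2)) (a+b+2+0≡a+[b+2] r b)) (m+n∸n≡m r (b + 2)))))
      where
      ir = high⇒i≤ nl
      not-max : hasTop ≡ true → r + b + 2 + 0 ≢ M
      not-max et xM = <-irrefl refl (subst (_≤ 2 * m) r≡1+2m (rb q r e))
        where
        r≡1+2m : r ≡ suc (2 * m)
        r≡1+2m = +-cancelʳ-≡ (b + 2) r (suc (2 * m))
          (trans (sym (a+b+2+0≡a+[b+2] r b)) (trans xM (trans (maxV≡topEntry et) (2a+b+3≡1+2a+[b+2] m b))))

    high-breakpoint : ∀ {q r} → f q ≡ just r → ¬ Low r (O q) → (suc (encodeRank b r (O q)) ≡ᵇ headEntry b) ≡ O q
    high-breakpoint {q} {r} e nl = subst (λ x → (suc x ≡ᵇ headEntry b) ≡ O q) (sym (encodeRank-high b nl))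
      (trans (≢⇒≡ᵇ-false (λ eq → <-irrefl refl (subst (suc (i + b) ≤_) (suc-injective eq)
                                                     (≤-trans (n≤1+n _) (head<high r (high⇒i≤ nl) (topBonus r))))))
             (sym (high⇒∉breakpoint e nl)))

    decode-breakpoint : ∀ q → (suc (encodeEntry b (f q) (O q)) ≡ᵇ headEntry b) ≡ O q
    decode-breakpoint q with f q in e
    ... | nothing = trans (≢⇒≡ᵇ-false (λ eq → <-irrefl refl (≤-trans (absent⇒1<b e) (≤-trans (m≤n+m b i) (≤-reflexive (sym (suc-injective eq)))))))
                     (sym (bool-cases (O q) (λ ot → bad (trans (sym e) (oi q ot))) (λ of → of)))
      where
      bad : nothing ≡ just i → O q ≡ false
      bad ()
    ... | just r with classify r (O q)
    ...   | top nl _ = high-breakpoint e nl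
    ...   | mid nl _ = high-breakpoint e nl
    ...   | low lw = subst (λ x → (suc x ≡ᵇ headEntry b) ≡ O q) (sym (encodeRank-low b lw))
        (bool-cases (O q)
          (λ ot → trans (subst (λ z → (suc (z + b) ≡ᵇ headEntry b) ≡ true) (sym (MP.just-injective (trans (sym e) (oi q ot))))
                          (≡ᵇ-refl (suc (i + b))))
                        (sym ot))
                     (λ of → trans (≢⇒≡ᵇ-false (λ eq → ltcase lw of (+-cancelʳ-≡ b r i (suc-injective eq)))) (sym of)))
      where
      ltcase : Low r (O q) → O q ≡ false → r ≡ i → ⊥
      ltcase (inj₁ lt) of eq = <-irrefl eq lt
      ltcase (inj₂ (_ , ot)) of eq with trans (sym of) ot
      ... | ()

    maxEntry≡ : 2 * m + b + 1 + 2 * tb ≡ maxEntry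
    maxEntry≡ = trans (cong (λ z → 2 * m + z + 1 + 2 * tb) eb) (2a+2b+1+2c≡1+2[a+b+c] m bb tb)

    2m+b+1≤maxEntry : 2 * m + b + 1 ≤ maxEntry
    2m+b+1≤maxEntry = subst (2 * m + b + 1 ≤_) maxEntry≡ (m≤m+n _ _)

    tb≡1 : hasTop ≡ true → tb ≡ 1
    tb≡1 refl = refl

    top≤maxEntry : hasTop ≡ true → 2 * m + b + 2 + 1 ≤ maxEntry
    top≤maxEntry et = subst (2 * m + b + 2 + 1 ≤_) maxEntry≡ (≤-reflexive (trans (a+2+1≡a+1+2*1 (2 * m + b)) (cong (λ z → 2 * m + b + 1 + 2 * z) (sym (tb≡1 et)))))

    entry≤maxEntry : ∀ q → encodeEntry b (f q) (O q) ≤ maxEntry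
    entry≤maxEntry q with f q in e
    ... | nothing = s≤s z≤n
    ... | just r with classify r (O q)
    ...   | low lw = ≤-trans (≤-reflexive (encodeRank-low b lw))
                       (≤-trans (+-monoˡ-≤ b (rb q r e)) (≤-trans (m≤m+n (2 * m + b) 1) 2m+b+1≤maxEntry))
    ...   | top nl eq = ≤-trans (≤-reflexive (trans (encodeRank-top b nl eq) (cong (λ z → z + b + 2 + 1) eq)))
                          (top≤maxEntry (top⇒hasTop q (trans e (cong just eq)) (high⇒∉breakpoint e nl)))
    ...   | mid nl ne = ≤-trans (≤-reflexive (trans (encodeRank-mid b nl ne) (a+b+2+0≡1+a+b+1 r b)))
                          (≤-trans (+-monoˡ-≤ 1 (+-monoˡ-≤ b (≤∧≢⇒< (rb q r e) ne))) 2m+b+1≤maxEntry)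

    entry-at : ∀ q x → encodeEntry b (f q) (O q) ≡ x → HasEntry g x
    entry-at q x eq = fs q , trans (lookup-rankVec b q) eq

    hi≤m : hi ≤ m
    hi≤m = *-cancelˡ-≤ 2 (subst (_≤ 2 * m) ei i≤)

    odd-entry-absent : hasAbsent ≡ true → HasEntry g 1
    odd-entry-absent et with hasAbsent⇒absent et
    ... | q , e = entry-at q 1 (cong (λ z → encodeEntry b z (O q)) e)

    odd-entry-above : ∀ k → hi ≤ k → suc k + bb ≤ H → HasEntry g (suc (2 * suc k) + b)
    odd-entry-above k hk le with k <? m
    ... | yes k<m with op k k<m
    ...   | q , eq = entry-at q _ (trans (cong (λ z → encodeEntry b z (O q)) eq)
                       (trans (encodeRank-mid b nl (odd≢even k m)) (1+2a+b+2+0≡1+2[1+a]+b k b)))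
      where
      i<r : i < suc (2 * k)
      i<r = s≤s (subst (_≤ 2 * k) (sym ei) (*-monoʳ-≤ 2 hk))
      nl : ¬ Low (suc (2 * k)) (O q)
      nl (inj₁ lt) = <-irrefl refl (<-trans lt i<r)
      nl (inj₂ (eq' , _)) = <-irrefl (sym eq') i<r
    odd-entry-above k hk le | no k≮m = subst (λ z → HasEntry g (suc (2 * suc z) + b)) (sym k≡m)
        (entry-at q _ (trans (cong (λ z → encodeEntry b z (O q)) eq) (trans (encodeRank-top b nl refl) (2a+b+2+1≡1+2[1+a]+b m b))))
      where
      le′ : suc k ≤ m + tb
      le′ = +-cancelʳ-≤ bb (suc k) (m + tb) (subst (suc k + bb ≤_) (trans (+-assoc m bb tb) (trans (cong (m +_) (+-comm bb tb)) (sym (+-assoc m tb bb)))) le)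
      m≤k : m ≤ k
      m≤k = ≮⇒≥ k≮m
      et : hasTop ≡ true
      et = bit-true hasTop (+-cancelˡ-≤ m 1 tb (subst (_≤ m + tb) (+-comm 1 m) (≤-trans (s≤s m≤k) le′)))
      k≡m : k ≡ m
      k≡m = ≤-antisym (≤-pred (≤-trans le′ (≤-reflexive (trans (cong (m +_) (tb≡1 et)) (+-comm m 1))))) m≤k
      q = proj₁ (hasTop⇒top et)
      eq = proj₁ (proj₂ (hasTop⇒top et))
      oq = proj₂ (proj₂ (hasTop⇒top et))
      nl : ¬ Low (2 * m) (O q)
      nl (inj₁ lt) = <-irrefl refl (<-≤-trans lt i≤)
      nl (inj₂ (_ , ot)) with trans (sym oq) ot
      ... | ()

    odd-entry-shifted : ∀ k → k + bb ≤ H → Tri (k < hi) (k ≡ hi) (hi < k) → HasEntry g (suc (2 * k) + b)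
    odd-entry-shifted k _ (tri< k<hi _ _) with op k (≤-trans k<hi hi≤m)
    ... | q , eq = entry-at q _ (trans (cong (λ z → encodeEntry b z (O q)) eq) (encodeRank-low b (inj₁ lw)))
      where
      lw : suc (2 * k) < i
      lw = subst (suc (2 * k) <_) (sym ei) (≤-trans (≤-reflexive (sym (*-suc 2 k))) (*-monoʳ-≤ 2 k<hi))
    odd-entry-shifted k _ (tri≈ _ k≡hi _) = fz , cong (λ z → suc (z + b)) (trans ei (cong (2 *_) (sym k≡hi)))
    odd-entry-shifted (suc k) le (tri> _ _ (s≤s hi≤k)) = odd-entry-above k hi≤k le

    odd-entry : ∀ k → k ≤ H → HasEntry g (suc (2 * k))
    odd-entry k le with k <? bb
    ... | yes k<bb = subst (λ z → HasEntry g (suc (2 * z))) (sym k≡0) (odd-entry-absent (bit-true hasAbsent (≤-trans (s≤s z≤n) k<bb)))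
      where
      k≡0 : k ≡ 0
      k≡0 = n≤0⇒n≡0 (≤-pred (≤-trans k<bb (bit≤1 hasAbsent)))
    ... | no k≮bb = subst (HasEntry g) (sym tgt) (odd-entry-shifted (k ∸ bb) (subst (_≤ H) (sym kk) le) (<-cmp (k ∸ bb) hi))
      where
      kk : k ∸ bb + bb ≡ k
      kk = m∸n+n≡m (≮⇒≥ k≮bb)
      tgt : suc (2 * k) ≡ suc (2 * (k ∸ bb)) + b
      tgt = trans (cong (λ z → suc (2 * z)) (sym kk)) (trans (1+2[a+b]≡1+2a+2b (k ∸ bb) bb) (cong (suc (2 * (k ∸ bb)) +_) (sym eb)))

    entries≤maxEntry : ∀ p → lookup g p ≤ maxEntry
    entries≤maxEntry fz = ≤-trans (≤-reflexive (+-comm 1 (i + b))) (≤-trans (+-monoˡ-≤ 1 (+-monoˡ-≤ b i≤)) 2m+b+1≤maxEntry)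
    entries≤maxEntry (fs q) = subst (_≤ maxEntry) (sym (lookup-rankVec b q)) (entry≤maxEntry q)

    odd-entries : ∀ o → o ≤ maxEntry → isOdd o ≡ true → HasEntry g o
    odd-entries o le oo with odd⇒1+2* oo
    ... | k , eq = subst (HasEntry g) (sym eq) (odd-entry k (*-cancelˡ-≤ 2 (≤-pred (subst (_≤ maxEntry) eq le))))

    vec-isTight : isTight g ≡ true
    vec-isTight = isTight-intro g maxEntry entries≤maxEntry (odd-entry H ≤-refl) (cong not (isOdd-2* H)) odd-entries

    vec-bounded : ∀ p → lookup g p < 2 * suc n
    vec-bounded p = ≤-trans (s≤s (entries≤maxEntry p)) (≤-trans (≤-reflexive (sym (*-suc 2 H))) (*-monoʳ-≤ 2 (oddEntries<length g H odd-entry)))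

    decode-vec : decodeRanked b hasTop g J ≈ ranked f O i J
    decode-vec = (λ q → trans (cong (decodeRank b hasTop (headEntry b) M) (lookup-rankVec b q)) (decode-rank q)) ,
           (λ q → trans (cong (λ x → suc x ≡ᵇ headEntry b) (lookup-rankVec b q)) (decode-breakpoint q)) ,
           m+n∸n≡m i b , (λ q → refl)

    encodeRanked : ∃ λ x → decode x ≈ ranked f O i J
    encodeRanked with decode-tight (tag hasAbsent hasTop) J g vec-bounded vec-isTight
    ... | x , e1 = x , ≈-trans (decode x) (decodeRanked b hasTop g J) (ranked f O i J)
                        (subst (decode x ≈_) (decodeVec-tag hasAbsent hasTop g J) e1) decode-vec

  bit-≡ᵇ1 : ∀ x → (bit x ≡ᵇ 1) ≡ x
  bit-≡ᵇ1 true = refl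
  bit-≡ᵇ1 false = refl

  encodeSubset : ∀ S → ∃ λ x → decode x ≈ subset S
  encodeSubset S with decode-tight fz (λ _ → fz) g bounded tg
    where
    g : Vec ℕ (suc n)
    g = 1 ∷ tabulate (λ q → bit (S q))
    le1 : ∀ p → lookup g p ≤ 1
    le1 fz = ≤-refl
    le1 (fs q) = subst (_≤ 1) (sym (lookup∘tabulate (λ q → bit (S q)) q)) (bit≤1 (S q))
    bounded : ∀ p → lookup g p < 2 * suc n
    bounded p = ≤-trans (s≤s (le1 p)) (*-monoʳ-≤ 2 (s≤s z≤n))
    tg : isTight g ≡ true
    tg = isTight-intro g 1 le1 (fz , refl) refl (λ o le oo → fz , sym (one o le oo))
      where
      one : ∀ o → o ≤ 1 → isOdd o ≡ true → o ≡ 1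
      one zero _ ()
      one (suc zero) _ _ = refl
      one (suc (suc o)) (s≤s ()) _
  ... | x , e = x , ≈-trans (decode x) _ (subset S) e (λ q → trans (cong (_≡ᵇ 1) (lookup∘tabulate (λ q → bit (S q)) q)) (bit-≡ᵇ1 (S q)))

  encode : ∀ s → WellFormed s → ∃ λ x → decode x ≈ s
  encode (subset S) _ = encodeSubset S
  encode (ranked f O i J) (m , (hi , ei) , i≤ , rb , op , oi) = by-flags (em {∃ λ q → f q ≡ nothing}) (em {∃ λ q → f q ≡ just (2 * m) × O q ≡ false})
    where
    d : RankedData
    d = record { f = f ; O = O ; i = i ; J = J ; m = m ; hi = hi ; ei = ei ; i≤ = i≤ ; rb = rb ; op = op ; oi = oi }
    by-flags : Dec (∃ λ q → f q ≡ nothing) → Dec (∃ λ q → f q ≡ just (2 * m) × O q ≡ false) → ∃ λ x → decode x ≈ ranked f O i J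
    by-flags (yes b) (yes t) = TightEncoding.encodeRanked d true true (λ _ _ → refl) (λ _ → b) (λ _ _ _ → refl) (λ _ → t)
    by-flags (yes b) (no nt) = TightEncoding.encodeRanked d true false (λ _ _ → refl) (λ _ → b) (λ q e o → ⊥-elim (nt (q , e , o))) (λ ())
    by-flags (no nb) (yes t) = TightEncoding.encodeRanked d false true (λ q e → ⊥-elim (nb (q , e))) (λ ()) (λ _ _ _ → refl) (λ _ → t)
    by-flags (no nb) (no nt) = TightEncoding.encodeRanked d false false (λ q e → ⊥-elim (nb (q , e))) (λ ()) (λ q e o → ⊥-elim (nt (q , e , o))) (λ ())

module ComplementAutomaton (em : ExcludedMiddle 0ℓ) {k ℓ' : ℕ} (A : ELA k (suc (suc ℓ'))) (eqa : ELA.acc A ≡ genRabinAcc (suc ℓ')) where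
  open States em A
  open Decoding em A using (decode; #states; Step-resp; Initial-resp; Accepting-resp; _≈_; ≈-sym)
  open Encoding em A using (encode)

  B : ELA k 1
  B = record
    { nStates = #states
    ; trans = λ x a y → holds (Step a (decode x) (decode y))
    ; init = λ x → holds (Initial (decode x))
    ; colour = λ x _ _ _ → holds (Accepting (decode x))
    ; acc = buchiAcc }

  accepts⇒rejects : ∀ w → Accepts B w → ¬ Accepts A w
  accepts⇒rejects w (ρ , acc) = Soundness.Rejection.sound em A w (λ t → decode (st t)) (holds⇒ start) (λ t → holds⇒ (step t))
                     (Often-map holds⇒ acc) eqa
    where open Run ρ

  rejects⇒accepts : ∀ w → ¬ Accepts A w → Accepts B w
  rejects⇒accepts w nacc = run , Often-map (λ {t} acc → ⇒holds (Accepting-resp _ _ (≈-sym _ _ (decode-code t)) acc)) C.σacc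
    where
    module C = ComplementRun em A w nacc eqa
    code : ℕ → Fin #states
    code t = proj₁ (encode (C.σ t) (C.σgood t))
    decode-code : ∀ t → decode (code t) ≈ C.σ t
    decode-code t = proj₂ (encode (C.σ t) (C.σgood t))
    run : Run B w
    run = record { st = code
                 ; start = ⇒holds (Initial-resp _ _ (≈-sym _ _ (decode-code 0)) C.σinit)
                 ; step = λ t → ⇒holds (Step-resp _ _ _ _ _ (≈-sym _ _ (decode-code t)) (≈-sym _ _ (decode-code (suc t))) (C.σstep t)) }

lemma11 : ExcludedMiddle 0ℓ →
    ∃ λ (C : ℕ) →
    ∀ (k ℓ : ℕ) → 1 ≤ ℓ → (A : ELA k (suc ℓ)) → ELA.acc A ≡ genRabinAcc ℓ →
    ∃ λ (B : ELA k 1) →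
    ELA.acc B ≡ buchiAcc
    × ELA.nStates B ≤ C * (ℓ ^ ELA.nStates A * tight (suc (ELA.nStates A)))
    × (∀ (w : Word k) → Accepts B w ⇔ (¬ Accepts A w))
lemma11 em = 5 , λ { k (suc ℓ') (s≤s z≤n) A eqa → ComplementAutomaton.B em A eqa , refl , ≤-refl ,
                       λ w → mk⇔ (ComplementAutomaton.accepts⇒rejects em A eqa w) (ComplementAutomaton.rejects⇒accepts em A eqa w) }
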